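{- Let $H_n$ denote the number of binary words of length $n$ whose only square subwords are among $00$, $11$ and $0101$. Then $H_n=\Omega(1.0006^n)$ and $H_n=O(1.135^n)$.
   Context: A square is a nonempty word of the form $xx$, considered as a contiguous subword. -}

module Defs where

open import Data.Bool using (Bool; true; false)
open import Data.Bool.Properties using () renaming (_≟_ to _≟ᵇ_)
open import Data.Nat using (ℕ; zero; suc; _+_; _*_; _≤_; _≤?_)
open import Data.Fin using (Fin; toℕ)
open import Data.Fin.Properties using (all?)
open import Data.List using (List; []; _∷_; length; take; drop; filter; map; _++_)
open import Data.List.Properties using (≡-dec)
open import Data.Product using (_×_)
open import Data.Sum using (_⊎_)
open import Relation.Nullary using (Dec)
open import Relation.Nullary.Decidable using (_×-dec_; _⊎-dec_; _→-dec_)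
open import Relation.Binary.PropositionalEquality using (_≡_)

-- Binary words: lists of booleans, false = 0, true = 1.
Word : Set
Word = List Bool

_≟w_ : (u v : Word) → Dec (u ≡ v)
_≟w_ = ≡-dec _≟ᵇ_

words : ℕ → List Word
words zero    = [] ∷ []
words (suc n) = map (false ∷_) (words n) ++ map (true ∷_) (words n)

factor : Word → ℕ → ℕ → Word
factor w i k = take k (drop i w)

SquareAt : Word → ℕ → ℕ → Set
SquareAt w i l = (1 ≤ l) × (i + (l + l) ≤ length w) × (factor w i l ≡ factor w (i + l) l)

w00 w11 w0101 : Word
w00   = false ∷ false ∷ []
w11   = true ∷ true ∷ []
w0101 = false ∷ true ∷ false ∷ true ∷ []

AllowedSquare : Word → Set
AllowedSquare s = (s ≡ w00) ⊎ (s ≡ w11) ⊎ (s ≡ w0101)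

-- every square factor of w is among 00, 11, 0101.
-- (Any square occurrence has i, l ≤ length w, so bounding by Fin (suc (length w)) loses nothing.)
OnlyAllowedSquares : Word → Set
OnlyAllowedSquares w = (i l : Fin (suc (length w))) →
  SquareAt w (toℕ i) (toℕ l) → AllowedSquare (factor w (toℕ i) (toℕ l + toℕ l))

onlyAllowedSquares? : (w : Word) → Dec (OnlyAllowedSquares w)
onlyAllowedSquares? w = all? λ i → all? λ l →
  (1 ≤? toℕ l ×-dec toℕ i + (toℕ l + toℕ l) ≤? length w
     ×-dec factor w (toℕ i) (toℕ l) ≟w factor w (toℕ i + toℕ l) (toℕ l))
  →-dec (let s = factor w (toℕ i) (toℕ l + toℕ l) in
         s ≟w w00 ⊎-dec s ≟w w11 ⊎-dec s ≟w w0101)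

H : ℕ → ℕ
H n = length (filter onlyAllowedSquares? (words n))

{-# OPTIONS --safe #-}
-- Lower bound: every ternary letter x has two images ternaryCode (x , false), ternaryCode (x , true) of
-- length 23, and choosing one image per letter of a squarefree ternary word always yields a squarefree
-- word; the 50-uniform binaryCode turns squarefree ternary words into binary words whose only squares are
-- 00, 11 and 0101. Both facts are instances of one criterion for uniform morphisms: synchronization plus
-- recognizability of a letter from a prefix or a suffix of its image pull long squares of an image back
-- to squares of the preimage, and short squares only involve images of words of length at most 5, which
-- are checked by computation. A squarefree ternary word of length k thus gives 2^k good binary words of
-- length 1150 k, and 2^(1/1150) > 1.0006.
--
-- Upper bound: give each good word a potential depending on its first 23 letters, such that the two
-- one-letter extensions 0w, 1w of a good word w have total potential at most 1.135 times that of w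
-- (checked on the good words of length 23). The total potential of the good words of length n then grows
-- at most like 1.135^n, and it dominates H n.
module Submission where

open import Data.Bool using (Bool; true; false; T; _∧_; if_then_else_)
open import Data.Bool.Properties using (T-∧) renaming (_≟_ to _≟ᵇ_)
open import Data.Empty using (⊥)
open import Data.Fin as Fin using (toℕ; fromℕ<)
open import Data.Fin.Properties using (toℕ<n; toℕ-fromℕ<)
open import Data.List using (List; []; _∷_; _++_; length; map; take; drop; filter; concat; concatMap; zip; zipWith; cartesianProduct; upTo)
open import Data.List.Properties
  using ( length-map; length-take; length-drop; length-++; take-take; take-drop; drop-drop; take-map; drop-map; take-[]; drop-[]
        ; ++-identityʳ; ∷-injectiveˡ; ∷-injectiveʳ; map-++; map-∘; map-id; concatMap-++; concatMap-map; ≡-dec )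
open import Data.List.Membership.Propositional using (_∈_)
open import Data.List.Membership.Propositional.Properties
  using (∈-map⁺; ∈-map⁻; ∈-++⁺ˡ; ∈-++⁺ʳ; ∈-++⁻; ∈-concatMap⁺; ∈-filter⁺; ∈-upTo⁺; ∈-cartesianProduct⁺)
open import Data.List.Relation.Unary.Any using (here; there)
import Data.List.Relation.Unary.Any as Any
import Data.List.Relation.Unary.All as All
open import Data.Nat
open import Data.Nat.DivMod using (_divMod_; result)
open import Data.Nat.ListAction using (sum)
open import Data.Nat.ListAction.Properties using (sum-++)
open import Data.Nat.Properties
open import Data.Nat.Tactic.RingSolver using (solve; solve-∀)
open import Data.Product using (_×_; _,_; proj₁; proj₂; ∃-syntax)
open import Data.Product.Properties using () renaming (≡-dec to ×-≡-dec)
open import Data.Sum using (inj₁; inj₂)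
open import Function.Base using (_∘_)
open import Function.Bundles using (Equivalence)
open import Relation.Binary using (DecidableEquality)
open import Relation.Binary.PropositionalEquality
open import Relation.Nullary using (Dec; does; isYes; yes; no; ¬_; contradiction)
open import Relation.Nullary.Decidable using (map′; T?; toWitness; fromWitness; ¬?; _×-dec_; _⊎-dec_; _→-dec_)
open import Relation.Unary using (Decidable)
open import Defs

private variable
  A B : Set

slice : List A → ℕ → ℕ → List A
slice w i k = take k (drop i w)

fits-drop : ∀ d (w : List A) {k} → d + k ≤ length w → k ≤ length (drop d w)
fits-drop d w {k} fits = subst (k ≤_) (sym (length-drop d w)) (m+n≤o⇒m≤o∸n k (subst (_≤ length w) (+-comm d k) fits))

drop-fits : ∀ d (w : List A) {k} → 1 ≤ k → k ≤ length (drop d w) → d + k ≤ length w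
drop-fits zero    w       k≥1 k≤ = k≤
drop-fits (suc d) []      k≥1 k≤ = contradiction (≤-trans k≥1 k≤) λ ()
drop-fits (suc d) (x ∷ w) k≥1 k≤ = s≤s (drop-fits d w k≥1 k≤)

length-slice : ∀ (w : List A) i k → i + k ≤ length w → length (slice w i k) ≡ k
length-slice w i k fits = begin
  length (take k (drop i w))  ≡⟨ length-take k (drop i w) ⟩
  k ⊓ length (drop i w)       ≡⟨ m≤n⇒m⊓n≡m (fits-drop i w fits) ⟩
  k                           ∎
  where open ≡-Reasoning

length-slice-≤ : ∀ (w : List A) d n → length (slice w d n) ≤ n
length-slice-≤ w d n = subst (_≤ n) (sym (length-take n (drop d w))) (m⊓n≤m n (length (drop d w)))

slice-fits : ∀ (w : List A) d n {k} → 1 ≤ k → k ≤ length (slice w d n) → d + k ≤ length w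
slice-fits w d n k≥1 k≤ = drop-fits d w k≥1 (≤-trans k≤ (subst (_≤ length (drop d w)) (sym (length-take n (drop d w))) (m⊓n≤n n _)))

take-slice : ∀ (w : List A) x {k n} → k ≤ n → take k (slice w x n) ≡ slice w x k
take-slice w x {k} {n} k≤n = trans (take-take k n (drop x w)) (cong (λ j → take j (drop x w)) (m≤n⇒m⊓n≡m k≤n))

drop-slice : ∀ (w : List A) x r n → drop r (slice w x (r + n)) ≡ slice w (x + r) n
drop-slice w x r n = trans (sym (take-drop n r (drop x w))) (cong (take n) (drop-drop x r w))

slice-slice : ∀ (w : List A) d r {k n} → r + k ≤ n → slice (slice w d n) r k ≡ slice w (d + r) k
slice-slice w d r {k} {n} r+k≤n = begin
  take k (drop r (slice w d n))              ≡⟨ cong (λ m → take k (drop r (slice w d m))) (sym (m+[n∸m]≡n r≤n)) ⟩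
  take k (drop r (slice w d (r + (n ∸ r))))  ≡⟨ cong (take k) (drop-slice w d r (n ∸ r)) ⟩
  take k (slice w (d + r) (n ∸ r))           ≡⟨ take-slice w (d + r) (m+n≤o⇒m≤o∸n k (subst (_≤ n) (+-comm r k) r+k≤n)) ⟩
  slice w (d + r) k                          ∎
  where
  open ≡-Reasoning
  r≤n : r ≤ n
  r≤n = m+n≤o⇒m≤o r r+k≤n

slice-map : ∀ (f : A → B) w i k → slice (map f w) i k ≡ map f (slice w i k)
slice-map f w i k = trans (cong (take k) (drop-map i w)) (take-map k (drop i w))

take-++-length : ∀ (xs : List A) n ys → take (length xs + n) (xs ++ ys) ≡ xs ++ take n ys
take-++-length []       n ys = refl
take-++-length (x ∷ xs) n ys = cong (x ∷_) (take-++-length xs n ys)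

drop-++-length : ∀ (xs : List A) n ys → drop (length xs + n) (xs ++ ys) ≡ drop n ys
drop-++-length []       n ys = refl
drop-++-length (x ∷ xs) n ys = drop-++-length xs n ys

drop-++-≤ : ∀ {r} (xs ys : List A) → r ≤ length xs → drop r (xs ++ ys) ≡ drop r xs ++ ys
drop-++-≤ {r = zero}  xs       ys _        = refl
drop-++-≤ {r = suc r} (x ∷ xs) ys (s≤s r≤) = drop-++-≤ xs ys r≤

++-injective : ∀ (xs ys : List A) {zs ws} → length xs ≡ length ys → xs ++ zs ≡ ys ++ ws → xs ≡ ys × zs ≡ ws
++-injective []       []       _   eq = refl , eq
++-injective (x ∷ xs) (y ∷ ys) len eq with ++-injective xs ys (suc-injective len) (∷-injectiveʳ eq)
... | xs≡ys , zs≡ws = cong₂ _∷_ (∷-injectiveˡ eq) xs≡ys , zs≡ws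

-- Squares
-- On binary words this is definitionally SquareAt from Defs.
IsSquareAt : List A → ℕ → ℕ → Set
IsSquareAt w i l = (1 ≤ l) × (i + (l + l) ≤ length w) × (slice w i l ≡ slice w (i + l) l)

SquaresSatisfy : (List A → Set) → List A → Set
SquaresSatisfy P w = ∀ i l → IsSquareAt w i l → P (slice w i (l + l))

SquareFree : List A → Set
SquareFree = SquaresSatisfy (λ _ → ⊥)

square-shift : ∀ {w : List A} {i q x n} → IsSquareAt w i q → i ≤ x → x + n ≤ i + q →
               slice w x n ≡ slice w (x + q) n
square-shift {w = w} {i} {q} {x} {n} (_ , _ , halves) i≤x x+n≤i+q = begin
  slice w x n                    ≡⟨ cong (λ y → slice w y n) i+d≡x ⟨
  slice w (i + d) n              ≡⟨ slice-slice w i d d+n≤q ⟨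
  slice (slice w i q) d n        ≡⟨ cong (λ u → slice u d n) halves ⟩
  slice (slice w (i + q) q) d n  ≡⟨ slice-slice w (i + q) d d+n≤q ⟩
  slice w (i + q + d) n          ≡⟨ cong (λ y → slice w y n) i+q+d≡x+q ⟩
  slice w (x + q) n              ∎
  where
  open ≡-Reasoning
  d = x ∸ i
  i+d≡x : i + d ≡ x
  i+d≡x = m+[n∸m]≡n i≤x
  i+q+d≡x+q : i + q + d ≡ x + q
  i+q+d≡x+q = trans (+-assoc i q d) (trans (cong (i +_) (+-comm q d)) (trans (sym (+-assoc i d q)) (cong (_+ q) i+d≡x)))
  d+n≤q : d + n ≤ q
  d+n≤q = +-cancelˡ-≤ i (d + n) q (subst (_≤ i + q) (trans (cong (_+ n) (sym i+d≡x)) (+-assoc i d n)) x+n≤i+q)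

square-∷ : ∀ {x : A} {w i l} → IsSquareAt w i l → IsSquareAt (x ∷ w) (suc i) l
square-∷ (l≥1 , fits , halves) = l≥1 , s≤s fits , halves

square-∷⁻ : ∀ {x : A} {w i l} → IsSquareAt (x ∷ w) (suc i) l → IsSquareAt w i l
square-∷⁻ (l≥1 , s≤s fits , halves) = l≥1 , fits , halves

square-map : ∀ (f : A → B) {w i l} → IsSquareAt w i l → IsSquareAt (map f w) i l
square-map f {w} {i} {l} (l≥1 , fits , halves) =
  l≥1 , subst (i + (l + l) ≤_) (sym (length-map f w)) fits ,
  trans (slice-map f w i l) (trans (cong (map f) halves) (sym (slice-map f w (i + l) l)))

square-in-window : ∀ {w : List A} {d r q} n → IsSquareAt w (d + r) q → r + (q + q) ≤ n → IsSquareAt (slice w d n) r q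
square-in-window {w = w} {d} {r} {q} n (q≥1 , fits , halves) r+2q≤n =
  q≥1 , fits′ , trans (slice-slice w d r (≤-trans (m≤m+n (r + q) q) r+q+q≤n))
                  (trans halves (trans (cong (λ j → slice w j q) (+-assoc d r q)) (sym (slice-slice w d (r + q) r+q+q≤n))))
  where
  r+q+q≤n : r + q + q ≤ n
  r+q+q≤n = subst (_≤ n) (sym (+-assoc r q q)) r+2q≤n
  fits′ : r + (q + q) ≤ length (slice w d n)
  fits′ = subst (r + (q + q) ≤_) (sym (length-take n (drop d w)))
    (⊓-glb r+2q≤n (fits-drop d w (subst (_≤ length w) (+-assoc d r (q + q)) fits)))

square-of-window : ∀ {w : List A} {d r q} n → IsSquareAt (slice w d n) r q → IsSquareAt w (d + r) q
square-of-window {w = w} {d} {r} {q} n (q≥1 , fits , halves) =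
  q≥1 , subst (_≤ length w) (sym (+-assoc d r (q + q))) (slice-fits w d n (≤-trans q≥1 (≤-trans (m≤n+m q q) (m≤n+m (q + q) r))) fits) ,
  trans (sym (slice-slice w d r (≤-trans (m≤m+n (r + q) q) r+2q≤n′)))
        (trans halves (trans (slice-slice w d (r + q) r+2q≤n′) (cong (λ j → slice w j q) (sym (+-assoc d r q)))))
  where
  r+2q≤n′ : r + q + q ≤ n
  r+2q≤n′ = subst (_≤ n) (sym (+-assoc r q q)) (≤-trans fits (length-slice-≤ w d n))

squaresSatisfy-slice : ∀ {P : List A → Set} {w} d n → SquaresSatisfy P w → SquaresSatisfy P (slice w d n)
squaresSatisfy-slice {P = P} {w} d n good r q sq =
  subst P (sym (slice-slice w d r (≤-trans (proj₁ (proj₂ sq)) (length-slice-≤ w d n)))) (good (d + r) q (square-of-window {w = w} {d} n sq))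

squaresSatisfy-tail : ∀ {P : List A → Set} {x w} → SquaresSatisfy P (x ∷ w) → SquaresSatisfy P w
squaresSatisfy-tail {x = x} {w} good i l sq = good (suc i) l (square-∷ {x = x} {w} {i} sq)

module SquareCheck {A : Set} (_≟_ : DecidableEquality A) {P : List A → Set} (P? : Decidable P) where

  agreeᵇ : ℕ → List A → List A → Bool
  agreeᵇ zero    _       _       = true
  agreeᵇ (suc l) (x ∷ t) (y ∷ u) = isYes (x ≟ y) ∧ agreeᵇ l t u
  agreeᵇ (suc l) _       _       = false

  agreeᵇ-sound : ∀ l t u → T (agreeᵇ l t u) → l ≤ length u × take l t ≡ take l u
  agreeᵇ-sound zero    t       u       _ = z≤n , refl
  agreeᵇ-sound (suc l) (x ∷ t) (y ∷ u) p with Equivalence.to T-∧ p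
  ... | x≈y , rest with agreeᵇ-sound l t u rest
  ...   | l≤ , agree = s≤s l≤ , cong₂ _∷_ (toWitness {a? = x ≟ y} x≈y) agree

  agreeᵇ-complete : ∀ l t u → l ≤ length u → take l t ≡ take l u → T (agreeᵇ l t u)
  agreeᵇ-complete zero    t       u       _       _     = _
  agreeᵇ-complete (suc l) []      (y ∷ u) _       ()
  agreeᵇ-complete (suc l) (x ∷ t) (y ∷ u) (s≤s l≤) agree =
    Equivalence.from T-∧ (fromWitness {a? = x ≟ y} (∷-injectiveˡ agree) , agreeᵇ-complete l t u l≤ (∷-injectiveʳ agree))

  headSquare⇒agreeᵇ : ∀ t l → IsSquareAt t 0 l → T (agreeᵇ l t (drop l t))
  headSquare⇒agreeᵇ t l (_ , fits , halves) = agreeᵇ-complete l t (drop l t) (fits-drop l t fits) halves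

  agreeᵇ⇒headSquare : ∀ t l → 1 ≤ l → T (agreeᵇ l t (drop l t)) → IsSquareAt t 0 l
  agreeᵇ⇒headSquare t l l≥1 p with agreeᵇ-sound l t (drop l t) p
  ... | l≤ , agree = l≥1 , drop-fits l t l≥1 l≤ , agree

  -- headSquaresOKᵇ t l u, called with u = drop l t, checks the squares at the head of t of half-length
  -- at least l; u doubles as the fuel of the recursion.
  headSquaresOKᵇ : List A → ℕ → List A → Bool
  headSquaresOKᵇ t l []          = true
  headSquaresOKᵇ t l u@(_ ∷ u′)  = (if agreeᵇ l t u then isYes (P? (take (l + l) t)) else true) ∧ headSquaresOKᵇ t (suc l) u′

  squaresOKᵇ : List A → Bool
  squaresOKᵇ []      = true
  squaresOKᵇ (x ∷ w) = headSquaresOKᵇ (x ∷ w) 1 w ∧ squaresOKᵇ w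

  private
    drop-step : ∀ l (t : List A) {y u} → y ∷ u ≡ drop l t → u ≡ drop (suc l) t
    drop-step l t {y} {u} eq = trans (cong (drop 1) eq) (trans (drop-drop l 1 t) (cong (λ k → drop k t) (+-comm l 1)))

    T-if⁻ : ∀ {b c} → T b → T (if b then c else true) → T c
    T-if⁻ {true} _ p = p

    T-if⁺ : ∀ {b c} → (T b → T c) → T (if b then c else true)
    T-if⁺ {false} _ = _
    T-if⁺ {true}  f = f _

  headSquaresOKᵇ-sound : ∀ t l u → u ≡ drop l t → T (headSquaresOKᵇ t l u) →
                  ∀ l′ → l ≤ l′ → IsSquareAt t 0 l′ → P (take (l′ + l′) t)
  headSquaresOKᵇ-sound t l [] u≡ _ l′ l≤l′ (l′≥1 , fits , _) =
    contradiction (subst (λ u → l′ ≤ length u) (sym u≡) (fits-drop l t (≤-trans (+-monoˡ-≤ l′ l≤l′) fits)))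
                  (λ l′≤0 → contradiction (≤-trans l′≥1 l′≤0) λ ())
  headSquaresOKᵇ-sound t l (y ∷ u) u≡ p l′ l≤l′ sq with Equivalence.to T-∧ p | m≤n⇒m<n∨m≡n l≤l′
  ... | this , _    | inj₂ refl = toWitness (T-if⁻ (subst (λ u → T (agreeᵇ l t u)) (sym u≡) (headSquare⇒agreeᵇ t l sq)) this)
  ... | _    , rest | inj₁ l<l′ = headSquaresOKᵇ-sound t (suc l) u (drop-step l t u≡) rest l′ l<l′ sq

  headSquaresOKᵇ-complete : ∀ t l u → u ≡ drop l t → 1 ≤ l → (∀ l′ → IsSquareAt t 0 l′ → P (take (l′ + l′) t)) →
                            T (headSquaresOKᵇ t l u)
  headSquaresOKᵇ-complete t l []      _  _   _    = _
  headSquaresOKᵇ-complete t l (y ∷ u) u≡ l≥1 good = Equivalence.from T-∧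
    ( T-if⁺ (λ agree → fromWitness (good l (agreeᵇ⇒headSquare t l l≥1 (subst (λ u → T (agreeᵇ l t u)) u≡ agree))))
    , headSquaresOKᵇ-complete t (suc l) u (drop-step l t u≡) (s≤s z≤n) good )

  squaresOKᵇ-sound : ∀ w → T (squaresOKᵇ w) → SquaresSatisfy P w
  squaresOKᵇ-sound []      _ i l (l≥1 , fits , _) =
    contradiction (≤-trans l≥1 (≤-trans (m≤n+m l l) (≤-trans (m≤n+m (l + l) i) fits))) λ ()
  squaresOKᵇ-sound (x ∷ w) p zero    l sq with Equivalence.to T-∧ p
  ... | head , _ = headSquaresOKᵇ-sound (x ∷ w) 1 w refl head l (proj₁ sq) sq
  squaresOKᵇ-sound (x ∷ w) p (suc i) l sq with Equivalence.to T-∧ p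
  ... | _ , rest = squaresOKᵇ-sound w rest i l (square-∷⁻ {x = x} {w} {i} sq)

  squaresOKᵇ-complete : ∀ w → SquaresSatisfy P w → T (squaresOKᵇ w)
  squaresOKᵇ-complete []      _    = _
  squaresOKᵇ-complete (x ∷ w) good = Equivalence.from T-∧
    (headSquaresOKᵇ-complete (x ∷ w) 1 w refl (s≤s z≤n) (good 0) , squaresOKᵇ-complete w (squaresSatisfy-tail {P = P} {x = x} good))

  squaresSatisfy? : Decidable (SquaresSatisfy P)
  squaresSatisfy? w = map′ (squaresOKᵇ-sound w) (squaresOKᵇ-complete w) (T? (squaresOKᵇ w))

-- Uniform morphisms
module UniformMorphism (h : A → List B) {L : ℕ} .⦃ _ : NonZero L ⦄ (uniform : ∀ a → length (h a) ≡ L) where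

  length-concatMap : ∀ w → length (concatMap h w) ≡ length w * L
  length-concatMap []      = refl
  length-concatMap (a ∷ w) = trans (length-++ (h a)) (cong₂ _+_ (uniform a) (length-concatMap w))

  drop-concatMap : ∀ k w → drop (k * L) (concatMap h w) ≡ concatMap h (drop k w)
  drop-concatMap zero    w       = refl
  drop-concatMap (suc k) []      = drop-[] (suc k * L)
  drop-concatMap (suc k) (a ∷ w) = begin
    drop (L + k * L) (h a ++ concatMap h w)           ≡⟨ cong (λ m → drop (m + k * L) (h a ++ concatMap h w)) (uniform a) ⟨
    drop (length (h a) + k * L) (h a ++ concatMap h w) ≡⟨ drop-++-length (h a) (k * L) (concatMap h w) ⟩
    drop (k * L) (concatMap h w)                      ≡⟨ drop-concatMap k w ⟩
    concatMap h (drop k w)                            ∎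
    where open ≡-Reasoning

  take-concatMap : ∀ k w → take (k * L) (concatMap h w) ≡ concatMap h (take k w)
  take-concatMap zero    w       = refl
  take-concatMap (suc k) []      = take-[] (suc k * L)
  take-concatMap (suc k) (a ∷ w) = begin
    take (L + k * L) (h a ++ concatMap h w)            ≡⟨ cong (λ m → take (m + k * L) (h a ++ concatMap h w)) (uniform a) ⟨
    take (length (h a) + k * L) (h a ++ concatMap h w) ≡⟨ take-++-length (h a) (k * L) (concatMap h w) ⟩
    h a ++ take (k * L) (concatMap h w)                ≡⟨ cong (h a ++_) (take-concatMap k w) ⟩
    h a ++ concatMap h (take k w)                      ∎
    where open ≡-Reasoning

  slice-concatMap : ∀ w k n → slice (concatMap h w) (k * L) (n * L) ≡ concatMap h (slice w k n)
  slice-concatMap w k n = trans (cong (take (n * L)) (drop-concatMap k w)) (take-concatMap n (drop k w))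

  module Recognizable {e} (e<L : e < L)
    (prefix-injective : ∀ a b → take (suc e) (h a) ≡ take (suc e) (h b) → a ≡ b)
    (suffix-injective : ∀ a b → drop e (h a) ≡ drop e (h b) → a ≡ b) where

    drop-concatMap-injective : ∀ {r} u v → r ≤ e → length u ≡ length v →
                               drop r (concatMap h u) ≡ drop r (concatMap h v) → u ≡ v
    drop-concatMap-injective []      []      _   _   _  = refl
    drop-concatMap-injective {r} (a ∷ u) (b ∷ v) r≤e len eq
      with ++-injective (drop r (h a)) (drop r (h b)) same-length
             (trans (sym (drop-++-≤ (h a) _ (r≤ a))) (trans eq (drop-++-≤ (h b) _ (r≤ b))))
      where
      r≤ : ∀ c → r ≤ length (h c)
      r≤ c = subst (r ≤_) (sym (uniform c)) (<⇒≤ (≤-<-trans r≤e e<L))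
      same-length : length (drop r (h a)) ≡ length (drop r (h b))
      same-length = trans (length-drop r (h a)) (trans (cong (_∸ r) (trans (uniform a) (sym (uniform b)))) (sym (length-drop r (h b))))
    ... | heads , tails = cong₂ _∷_ (suffix-injective a b (drop-more heads))
                                    (drop-concatMap-injective u v z≤n (suc-injective len) tails)
      where
      drop-more : drop r (h a) ≡ drop r (h b) → drop e (h a) ≡ drop e (h b)
      drop-more eq′ = subst (λ k → drop k (h a) ≡ drop k (h b)) (m+[n∸m]≡n r≤e)
        (trans (sym (drop-drop r (e ∸ r) (h a))) (trans (cong (drop (e ∸ r)) eq′) (drop-drop r (e ∸ r) (h b))))

    take-concatMap-injective : ∀ {r} n u v → e < r → length u ≡ suc n → length v ≡ suc n →
                               take (n * L + r) (concatMap h u) ≡ take (n * L + r) (concatMap h v) → u ≡ v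
    take-concatMap-injective {r} zero (a ∷ []) (b ∷ []) e<r _ _ eq =
      cong (_∷ []) (prefix-injective a b (begin
        take (suc e) (h a)                ≡⟨ cong (take (suc e)) (++-identityʳ (h a)) ⟨
        take (suc e) (h a ++ [])          ≡⟨ take-slice (h a ++ []) 0 e<r ⟨
        take (suc e) (take r (h a ++ [])) ≡⟨ cong (take (suc e)) eq ⟩
        take (suc e) (take r (h b ++ [])) ≡⟨ take-slice (h b ++ []) 0 e<r ⟩
        take (suc e) (h b ++ [])          ≡⟨ cong (take (suc e)) (++-identityʳ (h b)) ⟩
        take (suc e) (h b)                ∎))
      where open ≡-Reasoning
    take-concatMap-injective {r} (suc n) (a ∷ u) (b ∷ v) e<r lu lv eq
      with ++-injective (h a) (h b) (trans (uniform a) (sym (uniform b))) (trans (sym (split a u)) (trans eq (split b v)))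
      where
      split : ∀ c w → take (suc n * L + r) (h c ++ concatMap h w) ≡ h c ++ take (n * L + r) (concatMap h w)
      split c w = trans (cong (λ m → take m (h c ++ concatMap h w)) (trans (+-assoc L (n * L) r) (cong (_+ (n * L + r)) (sym (uniform c)))))
                        (take-++-length (h c) (n * L + r) (concatMap h w))
    ... | heads , tails = cong₂ _∷_ (prefix-injective a b (cong (take (suc e)) heads))
                                    (take-concatMap-injective n u v e<r (suc-injective lu) (suc-injective lv) tails)

  blocks-fit : ∀ w {k} → k * L ≤ length (concatMap h w) → k ≤ length w
  blocks-fit w {k} le = *-cancelʳ-≤ k (length w) L (subst (k * L ≤_) (length-concatMap w) le)

  blocks-fit-< : ∀ w {k} → k * L < length (concatMap h w) → k < length w
  blocks-fit-< w {k} lt = *-cancelʳ-< L k (length w) (subst (k * L <_) (length-concatMap w) lt)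

  block : ∀ w k → k + 1 ≤ length w → ∃[ a ] slice (concatMap h w) (k * L) L ≡ h a
  block w k fits with slice w k 1 | length-slice w k 1 fits | slice-concatMap w k 1
  ... | a ∷ [] | _ | eq = a , trans (cong (slice (concatMap h w) (k * L)) (sym (*-identityˡ L))) (trans eq (++-identityʳ (h a)))

  two-blocks : ∀ w k → k + 2 ≤ length w → ∃[ b ] ∃[ c ] slice (concatMap h w) (k * L) (L + L) ≡ h b ++ h c
  two-blocks w k fits with slice w k 2 | length-slice w k 2 fits | slice-concatMap w k 2
  ... | b ∷ c ∷ [] | _ | eq = b , c , trans (cong (λ n → slice (concatMap h w) (k * L) (L + n)) (sym (+-identityʳ L)))
                                            (trans eq (cong (h b ++_) (++-identityʳ (h c))))

  -- For a square of h(w) at i = r + s L with half-length q = r′ + m L ≥ 2 L: if r′ ≠ 0, a whole block in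
  -- the first half reappears at offset r′ inside two blocks, against synchronization; if r′ = 0, the two
  -- halves are images of equal-length runs of letters which recognizability identifies (through block
  -- suffixes when r ≤ e, block prefixes when r > e), giving a square in w.
  module SquareFreeImage {e} (e<L : e < L)
    (prefix-injective : ∀ a b → take (suc e) (h a) ≡ take (suc e) (h b) → a ≡ b)
    (suffix-injective : ∀ a b → drop e (h a) ≡ drop e (h b) → a ≡ b)
    (synchronizing : ∀ a b c r → 0 < r → r < L → slice (h b ++ h c) r L ≢ h a)
    {Q : List A → Set} (Q-slice : ∀ {w} d n → Q w → Q (slice w d n)) (Q-squareFree : ∀ {w} → Q w → SquareFree w)
    {P : List B → Set} (short-images : ∀ v → length v ≤ 5 → Q v → SquaresSatisfy P (concatMap h v)) where

    open Recognizable e<L prefix-injective suffix-injective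

    unsynchronized-square-absent : ∀ w {r s r′ m} → r < L → suc r′ < L → L + L ≤ suc r′ + m * L →
                                   ¬ IsSquareAt (concatMap h w) (r + s * L) (suc r′ + m * L)
    unsynchronized-square-absent w {r} {s} {r′} {m} r<L r′<L 2L≤q sq@(_ , fits , _) =
      contradict (block w (suc s) a-fits) (two-blocks w (suc s + m) bc-fits)
      where
      hw = concatMap h w
      q = suc r′ + m * L
      i+q+q≤ : r + s * L + q + q ≤ length hw
      i+q+q≤ = subst (_≤ length hw) (sym (+-assoc (r + s * L) q q)) fits
      i≤x : r + s * L ≤ suc s * L
      i≤x = +-monoˡ-≤ (s * L) (<⇒≤ r<L)
      x+L≤i+q : suc s * L + L ≤ r + s * L + q
      x+L≤i+q = begin
        suc s * L + L   ≡⟨ solve (s ∷ L ∷ []) ⟩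
        s * L + (L + L) ≤⟨ +-monoʳ-≤ (s * L) 2L≤q ⟩
        s * L + q       ≤⟨ +-monoˡ-≤ q (m≤n+m (s * L) r) ⟩
        r + s * L + q   ∎
        where open ≤-Reasoning
      a-fits : suc s + 1 ≤ length w
      a-fits = blocks-fit w (begin
        (suc s + 1) * L   ≡⟨ solve (s ∷ L ∷ []) ⟩
        suc s * L + L     ≤⟨ x+L≤i+q ⟩
        r + s * L + q     ≤⟨ m≤m+n _ q ⟩
        r + s * L + q + q ≤⟨ i+q+q≤ ⟩
        length hw          ∎)
        where open ≤-Reasoning
      bc-fits : suc s + m + 2 ≤ length w
      bc-fits = subst (_≤ length w) (sym (+-suc (suc s + m) 1)) (blocks-fit-< w (begin-strict
        (suc s + m + 1) * L         ≡⟨ solve (s ∷ m ∷ L ∷ []) ⟩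
        (suc s + m) * L + 0 + L     <⟨ +-monoˡ-< L (+-monoʳ-< ((suc s + m) * L) z<s) ⟩
        (suc s + m) * L + suc r′ + L ≡⟨ solve (s ∷ m ∷ L ∷ r′ ∷ []) ⟩
        suc s * L + L + (suc r′ + m * L) ≤⟨ +-monoˡ-≤ q x+L≤i+q ⟩
        r + s * L + q + q           ≤⟨ i+q+q≤ ⟩
        length hw                    ∎))
        where open ≤-Reasoning
      x+q≡ : (suc s + m) * L + suc r′ ≡ suc s * L + (suc r′ + m * L)
      x+q≡ = solve (s ∷ m ∷ L ∷ r′ ∷ [])
      contradict : (∃[ a ] slice hw (suc s * L) L ≡ h a) → (∃[ b ] ∃[ c ] slice hw ((suc s + m) * L) (L + L) ≡ h b ++ h c) → ⊥
      contradict (a , block-a) (b , c , block-bc) = synchronizing a b c (suc r′) z<s r′<L (begin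
        slice (h b ++ h c) (suc r′) L                              ≡⟨ cong (λ u → slice u (suc r′) L) block-bc ⟨
        slice (slice hw ((suc s + m) * L) (L + L)) (suc r′) L       ≡⟨ slice-slice hw ((suc s + m) * L) (suc r′) (+-monoˡ-≤ L (<⇒≤ r′<L)) ⟩
        slice hw ((suc s + m) * L + suc r′) L                       ≡⟨ cong (λ y → slice hw y L) x+q≡ ⟩
        slice hw (suc s * L + (suc r′ + m * L)) L                   ≡⟨ square-shift sq i≤x x+L≤i+q ⟨
        slice hw (suc s * L) L                                      ≡⟨ block-a ⟩
        h a                                                        ∎)
        where open ≡-Reasoning

    square-from-suffix : ∀ w {r s m} → r ≤ e → IsSquareAt (concatMap h w) (r + s * L) (suc m * L) → IsSquareAt w s (suc m)
    square-from-suffix w {r} {s} {m} r≤e sq@(_ , fits , _) =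
      s≤s z≤n , fits-w , drop-concatMap-injective u v r≤e (trans (length-slice w s M s+M≤) (sym (length-slice w (s + M) M s+M+M≤))) suffixes
      where
      M = suc m
      q = M * L
      hw = concatMap h w
      u = slice w s M
      v = slice w (s + M) M
      r≤q : r ≤ q
      r≤q = ≤-trans (<⇒≤ (≤-<-trans r≤e e<L)) (m≤m+n L (m * L))
      fits-w : s + (M + M) ≤ length w
      fits-w = blocks-fit w (begin
        (s + (M + M)) * L        ≡⟨ blocks≡ ⟩
        s * L + (q + q)          ≤⟨ m≤n+m _ r ⟩
        r + (s * L + (q + q))    ≡⟨ +-assoc r (s * L) (q + q) ⟨
        r + s * L + (q + q)      ≤⟨ fits ⟩
        length hw                ∎)
        where
        open ≤-Reasoning
        blocks≡ : (s + (suc m + suc m)) * L ≡ s * L + (suc m * L + suc m * L)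
        blocks≡ = solve (s ∷ m ∷ L ∷ [])
      s+M≤ : s + M ≤ length w
      s+M≤ = ≤-trans (+-monoʳ-≤ s (m≤m+n M M)) fits-w
      s+M+M≤ : s + M + M ≤ length w
      s+M+M≤ = subst (_≤ length w) (sym (+-assoc s M M)) fits-w
      dropped-block : ∀ k → drop r (concatMap h (slice w k M)) ≡ slice hw (k * L + r) (q ∸ r)
      dropped-block k = trans (cong (drop r) (sym (slice-concatMap w k M)))
                              (trans (cong (λ n → drop r (slice hw (k * L) n)) (sym (m+[n∸m]≡n r≤q))) (drop-slice hw (k * L) r (q ∸ r)))
      shifted-fits : s * L + r + (q ∸ r) ≤ r + s * L + q
      shifted-fits = begin
        s * L + r + (q ∸ r)   ≡⟨ +-assoc (s * L) r (q ∸ r) ⟩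
        s * L + (r + (q ∸ r)) ≡⟨ cong (s * L +_) (m+[n∸m]≡n r≤q) ⟩
        s * L + q             ≤⟨ +-monoˡ-≤ q (m≤n+m (s * L) r) ⟩
        r + s * L + q         ∎
        where open ≤-Reasoning
      x+q≡ : s * L + r + suc m * L ≡ (s + suc m) * L + r
      x+q≡ = solve (s ∷ r ∷ m ∷ L ∷ [])
      suffixes : drop r (concatMap h u) ≡ drop r (concatMap h v)
      suffixes = begin
        drop r (concatMap h u)             ≡⟨ dropped-block s ⟩
        slice hw (s * L + r) (q ∸ r)       ≡⟨ square-shift sq (≤-reflexive (+-comm r (s * L))) shifted-fits ⟩
        slice hw (s * L + r + q) (q ∸ r)   ≡⟨ cong (λ y → slice hw y (q ∸ r)) x+q≡ ⟩
        slice hw ((s + M) * L + r) (q ∸ r) ≡⟨ dropped-block (s + M) ⟨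
        drop r (concatMap h v)             ∎
        where open ≡-Reasoning

    square-from-prefix : ∀ w {r s m} → e < r → r < L → IsSquareAt (concatMap h w) (r + s * L) (suc m * L) → IsSquareAt w (suc s) (suc m)
    square-from-prefix w {r} {s} {m} e<r r<L sq@(_ , fits , _) =
      s≤s z≤n , fits-w , take-concatMap-injective m u v e<r (length-slice w (suc s) M s+M≤) (length-slice w (suc s + M) M s+M+M≤) prefixes
      where
      M = suc m
      q = M * L
      hw = concatMap h w
      u = slice w (suc s) M
      v = slice w (suc s + M) M
      fits-w : suc s + (M + M) ≤ length w
      fits-w = blocks-fit-< w (begin-strict
        (s + (M + M)) * L       ≡⟨ blocks≡ ⟩
        0 + s * L + (q + q)     <⟨ +-monoˡ-< (q + q) (+-monoˡ-< (s * L) (≤-<-trans z≤n e<r)) ⟩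
        r + s * L + (q + q)     ≤⟨ fits ⟩
        length hw               ∎)
        where
        open ≤-Reasoning
        blocks≡ : (s + (suc m + suc m)) * L ≡ 0 + s * L + (suc m * L + suc m * L)
        blocks≡ = solve (s ∷ m ∷ L ∷ [])
      s+M≤ : suc s + M ≤ length w
      s+M≤ = ≤-trans (+-monoʳ-≤ (suc s) (m≤m+n M M)) fits-w
      s+M+M≤ : suc s + M + M ≤ length w
      s+M+M≤ = subst (_≤ length w) (sym (+-assoc (suc s) M M)) fits-w
      taken-block : ∀ k → take (m * L + r) (concatMap h (slice w k M)) ≡ slice hw (k * L) (m * L + r)
      taken-block k = trans (cong (take (m * L + r)) (sym (slice-concatMap w k M)))
                            (take-slice hw (k * L) (≤-trans (+-monoʳ-≤ (m * L) (<⇒≤ r<L)) (≤-reflexive (+-comm (m * L) L))))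
      shifted-end : suc s * L + (m * L + r) ≡ r + s * L + suc m * L
      shifted-end = solve (s ∷ m ∷ L ∷ r ∷ [])
      x+q≡ : suc s * L + suc m * L ≡ (suc s + suc m) * L
      x+q≡ = solve (s ∷ m ∷ L ∷ [])
      prefixes : take (m * L + r) (concatMap h u) ≡ take (m * L + r) (concatMap h v)
      prefixes = begin
        take (m * L + r) (concatMap h u)       ≡⟨ taken-block (suc s) ⟩
        slice hw (suc s * L) (m * L + r)       ≡⟨ square-shift sq (+-monoˡ-≤ (s * L) (<⇒≤ r<L)) (≤-reflexive shifted-end) ⟩
        slice hw (suc s * L + q) (m * L + r)   ≡⟨ cong (λ y → slice hw y (m * L + r)) x+q≡ ⟩
        slice hw ((suc s + M) * L) (m * L + r) ≡⟨ taken-block (suc s + M) ⟨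
        take (m * L + r) (concatMap h v)       ∎
        where open ≡-Reasoning

    aligned-square-absent : ∀ {w} → Q w → ∀ {r s m} → r < L → ¬ IsSquareAt (concatMap h w) (r + s * L) (m * L)
    aligned-square-absent Qw {m = zero}  _   (() , _)
    aligned-square-absent {w} Qw {r} {s} {suc m} r<L sq with r ≤? e
    ... | yes r≤e = Q-squareFree Qw s (suc m) (square-from-suffix w r≤e sq)
    ... | no  r≰e = Q-squareFree Qw (suc s) (suc m) (square-from-prefix w (≰⇒> r≰e) r<L sq)

    long-square-absent : ∀ {w} → Q w → ∀ {i q} → L + L ≤ q → ¬ IsSquareAt (concatMap h w) i q
    long-square-absent {w} Qw {i} {q} 2L≤q sq with i divMod L | q divMod L
    ... | result s r refl | result m Fin.zero      refl = aligned-square-absent Qw {toℕ r} {s} {m} (toℕ<n r) sq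
    ... | result s r refl | result m (Fin.suc r′) refl =
      unsynchronized-square-absent w {toℕ r} {s} {toℕ r′} {m} (toℕ<n r) (toℕ<n (Fin.suc r′)) 2L≤q sq

    short-square-satisfies : ∀ {w} → Q w → ∀ {i q} → q < L + L → IsSquareAt (concatMap h w) i q → P (slice (concatMap h w) i (q + q))
    short-square-satisfies {w} Qw {i} {q} q<2L sq with i divMod L
    ... | result s r refl = subst P window-slice (short-images (slice w s 5) (length-slice-≤ w s 5) (Q-slice s 5 Qw) (toℕ r) q sq′)
      where
      hw = concatMap h w
      r+2q≤5L : toℕ r + (q + q) ≤ 5 * L
      r+2q≤5L = ≤-trans (+-mono-≤ (<⇒≤ (toℕ<n r)) (+-mono-≤ (<⇒≤ q<2L) (<⇒≤ q<2L))) (≤-reflexive (solve (L ∷ [])))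
      window : slice hw (s * L) (5 * L) ≡ concatMap h (slice w s 5)
      window = slice-concatMap w s 5
      sq′ : IsSquareAt (concatMap h (slice w s 5)) (toℕ r) q
      sq′ = subst (λ u → IsSquareAt u (toℕ r) q) window
              (square-in-window {w = hw} {s * L} (5 * L) (subst (λ j → IsSquareAt hw j q) (+-comm (toℕ r) (s * L)) sq) r+2q≤5L)
      window-slice : slice (concatMap h (slice w s 5)) (toℕ r) (q + q) ≡ slice hw (toℕ r + s * L) (q + q)
      window-slice = trans (cong (λ u → slice u (toℕ r) (q + q)) (sym window))
                           (trans (slice-slice hw (s * L) (toℕ r) r+2q≤5L) (cong (λ j → slice hw j (q + q)) (+-comm (s * L) (toℕ r))))

    concatMap-squaresSatisfy : ∀ {w} → Q w → SquaresSatisfy P (concatMap h w)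
    concatMap-squaresSatisfy Qw i q sq with q <? L + L
    ... | yes q<2L = short-square-satisfies Qw {i} q<2L sq
    ... | no  q≮2L = contradiction sq (long-square-absent Qw {i} (≮⇒≥ q≮2L))

-- Counting words
module Enumeration {A : Set} (letters : List A) (complete : ∀ a → a ∈ letters) where

  ∀? : ∀ {P : A → Set} → Decidable P → Dec (∀ a → P a)
  ∀? P? = map′ (λ all a → All.lookup all (complete a)) (λ f → All.tabulate (λ {a} _ → f a)) (All.all? P? letters)

  extensions : ∀ {P : List A → Set} → Decidable P → ℕ → List (List A)
  extensions P? zero    = [] ∷ []
  extensions P? (suc n) = concatMap (λ w → filter P? (map (_∷ w) letters)) (extensions P? n)

  ∈-extensions : ∀ {P : List A → Set} (P? : Decidable P) → (∀ {a w} → P (a ∷ w) → P w) →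
                 ∀ w → P w → w ∈ extensions P? (length w)
  ∈-extensions P? suffix-closed []      _   = here refl
  ∈-extensions P? suffix-closed (a ∷ w) Paw =
    ∈-concatMap⁺ (λ w → filter P? (map (_∷ w) letters))
      (Any.map (λ { refl → ∈-filter⁺ P? (∈-map⁺ (_∷ w) (complete a)) Paw }) (∈-extensions P? suffix-closed w (suffix-closed Paw)))

  ∈-extensions-upTo : ∀ {P : List A → Set} (P? : Decidable P) → (∀ {a w} → P (a ∷ w) → P w) →
                      ∀ {k} w → length w ≤ k → P w → w ∈ concatMap (extensions P?) (upTo (suc k))
  ∈-extensions-upTo P? suffix-closed w len≤k Pw =
    ∈-concatMap⁺ (extensions P?) (Any.map (λ { refl → ∈-extensions P? suffix-closed w Pw }) (∈-upTo⁺ (s≤s len≤k)))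

indicator : ∀ {P : A → Set} → Decidable P → A → ℕ
indicator P? x = if does (P? x) then 1 else 0

indicator-yes : ∀ {P : A → Set} (P? : Decidable P) {x} → P x → indicator P? x ≡ 1
indicator-yes P? {x} Px with P? x
... | yes _  = refl
... | no ¬Px = contradiction Px ¬Px

indicator-no : ∀ {P : A → Set} (P? : Decidable P) {x} → ¬ P x → indicator P? x ≡ 0
indicator-no P? {x} ¬Px with P? x
... | yes Px = contradiction Px ¬Px
... | no  _  = refl

indicator≤1 : ∀ {P : A → Set} (P? : Decidable P) x → indicator P? x ≤ 1
indicator≤1 P? x with does (P? x)
... | true  = ≤-refl
... | false = z≤n

indicator-mono : ∀ {P Q : A → Set} (P? : Decidable P) (Q? : Decidable Q) {x y} → (P x → Q y) → indicator P? x ≤ indicator Q? y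
indicator-mono P? Q? {x} {y} P⇒Q with P? x | Q? y
... | yes Px | yes _  = ≤-refl
... | yes Px | no ¬Qy = contradiction (P⇒Q Px) ¬Qy
... | no  _  | _      = z≤n

length-filter≡sum : ∀ {P : A → Set} (P? : Decidable P) xs → length (filter P? xs) ≡ sum (map (indicator P?) xs)
length-filter≡sum P? []       = refl
length-filter≡sum P? (x ∷ xs) with does (P? x)
... | true  = cong suc (length-filter≡sum P? xs)
... | false = length-filter≡sum P? xs

sum-map-+ : ∀ (f g : A → ℕ) xs → sum (map f xs) + sum (map g xs) ≡ sum (map (λ x → f x + g x) xs)
sum-map-+ f g []       = refl
sum-map-+ f g (x ∷ xs) = trans (+-exchange (f x) (sum (map f xs)) (g x) (sum (map g xs))) (cong (f x + g x +_) (sum-map-+ f g xs))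
  where
  +-exchange : ∀ a b c d → a + b + (c + d) ≡ a + c + (b + d)
  +-exchange = solve-∀

sum-map-*ʳ : ∀ (f : A → ℕ) c xs → sum (map f xs) * c ≡ sum (map (λ x → f x * c) xs)
sum-map-*ʳ f c []       = refl
sum-map-*ʳ f c (x ∷ xs) = trans (*-distribʳ-+ c (f x) (sum (map f xs))) (cong (f x * c +_) (sum-map-*ʳ f c xs))

sum-map-mono : ∀ {f g : A → ℕ} xs → (∀ {x} → x ∈ xs → f x ≤ g x) → sum (map f xs) ≤ sum (map g xs)
sum-map-mono []       _  = z≤n
sum-map-mono (x ∷ xs) f≤g = +-mono-≤ (f≤g (here refl)) (sum-map-mono xs (f≤g ∘ there))

sum-map-∈ : ∀ (f : A → ℕ) {x xs} → x ∈ xs → f x ≤ sum (map f xs)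
sum-map-∈ f (here refl) = m≤m+n _ _
sum-map-∈ f {xs = z ∷ _} (there x∈) = ≤-trans (sum-map-∈ f x∈) (m≤n+m _ (f z))

sum-map-pair : ∀ (f : A → ℕ) {x y xs} → x ≢ y → x ∈ xs → y ∈ xs → f x + f y ≤ sum (map f xs)
sum-map-pair f x≢y (here refl) (here refl) = contradiction refl x≢y
sum-map-pair f x≢y (here refl) (there y∈) = +-monoʳ-≤ (f _) (sum-map-∈ f y∈)
sum-map-pair f {x} {y} x≢y (there x∈) (here refl) = ≤-trans (≤-reflexive (+-comm (f x) (f y))) (+-monoʳ-≤ (f y) (sum-map-∈ f x∈))
sum-map-pair f {xs = z ∷ _} x≢y (there x∈) (there y∈) = ≤-trans (sum-map-pair f x≢y x∈ y∈) (m≤n+m _ (f z))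

sumWords : ℕ → (Word → ℕ) → ℕ
sumWords n f = sum (map f (words n))

sumWords-suc : ∀ n f → sumWords (suc n) f ≡ sumWords n (f ∘ (false ∷_)) + sumWords n (f ∘ (true ∷_))
sumWords-suc n f = begin
  sum (map f (map (false ∷_) ws ++ map (true ∷_) ws))               ≡⟨ cong sum (map-++ f (map (false ∷_) ws) _) ⟩
  sum (map f (map (false ∷_) ws) ++ map f (map (true ∷_) ws))       ≡⟨ sum-++ (map f (map (false ∷_) ws)) _ ⟩
  sum (map f (map (false ∷_) ws)) + sum (map f (map (true ∷_) ws))  ≡⟨ cong₂ _+_ (cong sum (map-∘ ws)) (cong sum (map-∘ ws)) ⟨
  sumWords n (f ∘ (false ∷_)) + sumWords n (f ∘ (true ∷_))          ∎
  where
  open ≡-Reasoning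
  ws = words n

∈-words : ∀ w → w ∈ words (length w)
∈-words []          = here refl
∈-words (false ∷ w) = ∈-++⁺ˡ (∈-map⁺ (false ∷_) (∈-words w))
∈-words (true ∷ w)  = ∈-++⁺ʳ (map (false ∷_) (words (length w))) (∈-map⁺ (true ∷_) (∈-words w))

length-∈-words : ∀ n {w} → w ∈ words n → length w ≡ n
length-∈-words zero    (here refl) = refl
length-∈-words (suc n) w∈ with ∈-++⁻ (map (false ∷_) (words n)) w∈
... | inj₁ w∈₀ with ∈-map⁻ (false ∷_) w∈₀
...   | _ , w′∈ , refl = cong suc (length-∈-words n w′∈)
length-∈-words (suc n) w∈ | inj₂ w∈₁ with ∈-map⁻ (true ∷_) w∈₁
...   | _ , w′∈ , refl = cong suc (length-∈-words n w′∈)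

sumWords-mono : ∀ n {f g} → (∀ w → length w ≡ n → f w ≤ g w) → sumWords n f ≤ sumWords n g
sumWords-mono n f≤g = sum-map-mono (words n) (λ w∈ → f≤g _ (length-∈-words n w∈))

sumWords-const : ∀ n c → sumWords n (λ _ → c) ≡ 2 ^ n * c
sumWords-const zero    c = refl
sumWords-const (suc n) c = begin
  sumWords (suc n) (λ _ → c)                      ≡⟨ sumWords-suc n (λ _ → c) ⟩
  sumWords n (λ _ → c) + sumWords n (λ _ → c)     ≡⟨ cong₂ _+_ (sumWords-const n c) (sumWords-const n c) ⟩
  2 ^ n * c + 2 ^ n * c                           ≡⟨ double (2 ^ n) c ⟩
  2 * 2 ^ n * c                                   ∎
  where
  open ≡-Reasoning
  double : ∀ x c → x * c + x * c ≡ 2 * x * c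
  double = solve-∀

sumWords-++ : ∀ a b f → sumWords (a + b) f ≡ sumWords a (λ u → sumWords b (λ v → f (u ++ v)))
sumWords-++ zero    b f = sym (+-identityʳ (sumWords b f))
sumWords-++ (suc a) b f = begin
  sumWords (suc (a + b)) f                                              ≡⟨ sumWords-suc (a + b) f ⟩
  sumWords (a + b) (f ∘ (false ∷_)) + sumWords (a + b) (f ∘ (true ∷_))  ≡⟨ cong₂ _+_ (split false) (split true) ⟩
  sumWords a (blocks ∘ (false ∷_)) + sumWords a (blocks ∘ (true ∷_))    ≡⟨ sumWords-suc a blocks ⟨
  sumWords (suc a) blocks                                               ∎
  where
  open ≡-Reasoning
  blocks : Word → ℕ
  blocks u = sumWords b (λ v → f (u ++ v))
  split : ∀ x → sumWords (a + b) (f ∘ (x ∷_)) ≡ sumWords a (blocks ∘ (x ∷_))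
  split x = sumWords-++ a b (f ∘ (x ∷_))

sumWords-pair : ∀ n f {u v} → u ≢ v → length u ≡ n → length v ≡ n → f u + f v ≤ sumWords n f
sumWords-pair n f {u} {v} u≢v refl lv = sum-map-pair f u≢v (∈-words u) (subst (λ k → v ∈ words k) lv (∈-words v))

sumWords-step : ∀ n {f g} a b → (∀ w → length w ≡ n → (f (false ∷ w) + f (true ∷ w)) * a ≤ g w * b) →
                sumWords (suc n) f * a ≤ sumWords n g * b
sumWords-step n {f} {g} a b step = begin
  sumWords (suc n) f * a                                           ≡⟨ cong (_* a) (sumWords-suc n f) ⟩
  (sumWords n (f ∘ (false ∷_)) + sumWords n (f ∘ (true ∷_))) * a   ≡⟨ cong (_* a) (sum-map-+ _ _ (words n)) ⟩
  sumWords n (λ w → f (false ∷ w) + f (true ∷ w)) * a              ≡⟨ sum-map-*ʳ _ a (words n) ⟩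
  sumWords n (λ w → (f (false ∷ w) + f (true ∷ w)) * a)            ≤⟨ sumWords-mono n step ⟩
  sumWords n (λ w → g w * b)                                       ≡⟨ sum-map-*ʳ g b (words n) ⟨
  sumWords n g * b                                                 ∎
  where open ≤-Reasoning

count-choices : ∀ {X : Set} {L} (block : X → Bool → Word) →
                (∀ x b → length (block x b) ≡ L) → (∀ x → block x false ≢ block x true) →
                ∀ s {P : Word → Set} (P? : Decidable P) →
                (∀ c → length c ≡ length s → P (concat (zipWith block s c))) →
                2 ^ length s ≤ sumWords (length s * L) (indicator P?)
count-choices block length-block distinct [] P? all = ≤-reflexive (cong (_+ 0) (sym (indicator-yes P? (all [] refl))))
count-choices {L = L} block length-block distinct (x ∷ s) P? all = begin
  2 ^ suc (length s)                            ≡⟨ cong (2 ^ length s +_) (+-identityʳ (2 ^ length s)) ⟩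
  2 ^ length s + 2 ^ length s                   ≤⟨ +-mono-≤ (choose false) (choose true) ⟩
  after (block x false) + after (block x true)  ≤⟨ sumWords-pair L after (distinct x) (length-block x false) (length-block x true) ⟩
  sumWords L after                              ≡⟨ sumWords-++ L R (indicator P?) ⟨
  sumWords (L + R) (indicator P?)               ∎
  where
  open ≤-Reasoning
  R = length s * L
  after : Word → ℕ
  after u = sumWords R (λ v → indicator P? (u ++ v))
  choose : ∀ b → 2 ^ length s ≤ after (block x b)
  choose b = count-choices block length-block distinct s (λ v → P? (block x b ++ v)) (λ c len → all (b ∷ c) (cong suc len))

^-distribʳ-* : ∀ m n k → (m * n) ^ k ≡ m ^ k * n ^ k
^-distribʳ-* m n zero    = refl
^-distribʳ-* m n (suc k) = trans (cong (m * n *_) (^-distribʳ-* m n k)) (interchange m n (m ^ k) (n ^ k))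
  where
  interchange : ∀ a b c d → a * b * (c * d) ≡ a * c * (b * d)
  interchange = solve-∀

geometric-growth : ∀ (f : ℕ → ℕ) {N a b} → (∀ n → N ≤ n → f (suc n) * a ≤ f n * b) → ∀ m → f (N + m) * a ^ m ≤ f N * b ^ m
geometric-growth f {N}         step zero    = ≤-reflexive (cong (λ k → f k * 1) (+-identityʳ N))
geometric-growth f {N} {a} {b} step (suc m) = begin
  f (N + suc m) * (a * a ^ m)    ≡⟨ cong (λ k → f k * (a * a ^ m)) (+-suc N m) ⟩
  f (suc (N + m)) * (a * a ^ m)  ≡⟨ *-assoc (f (suc (N + m))) a (a ^ m) ⟨
  f (suc (N + m)) * a * a ^ m    ≤⟨ *-monoˡ-≤ (a ^ m) (step (N + m) (m≤m+n N m)) ⟩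
  f (N + m) * b * a ^ m          ≡⟨ swap (f (N + m)) b (a ^ m) ⟩
  f (N + m) * a ^ m * b          ≤⟨ *-monoˡ-≤ b (geometric-growth f step m) ⟩
  f N * b ^ m * b                ≡⟨ swap′ (f N) (b ^ m) b ⟩
  f N * (b * b ^ m)              ∎
  where
  open ≤-Reasoning
  swap : ∀ x y z → x * y * z ≡ x * z * y
  swap = solve-∀
  swap′ : ∀ x y z → x * y * z ≡ x * (z * y)
  swap′ = solve-∀

exponential-upper : ∀ (g f : ℕ → ℕ) {N a b C} → a ≤ b → (∀ n → N ≤ n → g n ≤ f n) →
                    (∀ n → N ≤ n → f (suc n) * a ≤ f n * b) → f N ≤ C → ∀ n → N ≤ n → a ^ n * g n ≤ C * b ^ n
exponential-upper g f {N} {a} {b} {C} a≤b g≤f step fN≤C n N≤n with m≤n⇒∃[o]m+o≡n N≤n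
... | m , refl = begin
  a ^ (N + m) * g (N + m)        ≤⟨ *-monoʳ-≤ (a ^ (N + m)) (g≤f (N + m) N≤n) ⟩
  a ^ (N + m) * f (N + m)        ≡⟨ cong (_* f (N + m)) (^-distribˡ-+-* a N m) ⟩
  a ^ N * a ^ m * f (N + m)      ≡⟨ rearrange (a ^ N) (a ^ m) (f (N + m)) ⟩
  f (N + m) * a ^ m * a ^ N      ≤⟨ *-mono-≤ (geometric-growth f step m) (^-monoˡ-≤ N a≤b) ⟩
  f N * b ^ m * b ^ N            ≤⟨ *-monoˡ-≤ (b ^ N) (*-monoˡ-≤ (b ^ m) fN≤C) ⟩
  C * b ^ m * b ^ N              ≡⟨ rearrange′ C (b ^ m) (b ^ N) ⟩
  C * (b ^ N * b ^ m)            ≡⟨ cong (C *_) (^-distribˡ-+-* b N m) ⟨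
  C * b ^ (N + m)                ∎
  where
  open ≤-Reasoning
  rearrange : ∀ x y z → x * y * z ≡ z * y * x
  rearrange = solve-∀
  rearrange′ : ∀ x y z → x * y * z ≡ x * (z * y)
  rearrange′ = solve-∀

exponential-lower : ∀ (f : ℕ → ℕ) {p x y} .⦃ _ : NonZero p ⦄ .⦃ _ : NonZero x ⦄ .⦃ _ : NonZero y ⦄ →
                    x ^ p ≤ 2 * y ^ p → (∀ k → 2 ^ k ≤ f (k * p)) → (∀ n j → f (n + j) ≤ 2 ^ j * f n) →
                    ∀ n → x ^ n ≤ (2 * y) ^ p * (y ^ n * f n)
exponential-lower f {p} {x} {y} base blocks growth n with n divMod p
... | result s r refl = begin
  x ^ n                                   ≤⟨ ^-monoʳ-≤ x (m≤m+n n j) ⟩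
  x ^ (n + j)                             ≡⟨ cong (x ^_) (trans n+j≡ (*-comm k p)) ⟩
  x ^ (p * k)                             ≡⟨ ^-*-assoc x p k ⟨
  (x ^ p) ^ k                             ≤⟨ ^-monoˡ-≤ k base ⟩
  (2 * y ^ p) ^ k                         ≡⟨ ^-distribʳ-* 2 (y ^ p) k ⟩
  2 ^ k * (y ^ p) ^ k                     ≡⟨ cong (2 ^ k *_) (trans (^-*-assoc y p k) (cong (y ^_) (trans (*-comm p k) (sym n+j≡)))) ⟩
  2 ^ k * y ^ (n + j)                     ≤⟨ *-monoˡ-≤ (y ^ (n + j)) (subst (λ m → 2 ^ k ≤ f m) (sym n+j≡) (blocks k)) ⟩
  f (n + j) * y ^ (n + j)                 ≤⟨ *-monoˡ-≤ (y ^ (n + j)) (growth n j) ⟩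
  2 ^ j * f n * y ^ (n + j)               ≡⟨ cong (2 ^ j * f n *_) (^-distribˡ-+-* y n j) ⟩
  2 ^ j * f n * (y ^ n * y ^ j)           ≡⟨ rearrange (2 ^ j) (f n) (y ^ n) (y ^ j) ⟩
  2 ^ j * y ^ j * (y ^ n * f n)           ≡⟨ cong (_* (y ^ n * f n)) (^-distribʳ-* 2 y j) ⟨
  (2 * y) ^ j * (y ^ n * f n)             ≤⟨ *-monoˡ-≤ (y ^ n * f n) (^-monoʳ-≤ (2 * y) ⦃ m*n≢0 2 y ⦄ j≤p) ⟩
  (2 * y) ^ p * (y ^ n * f n)             ∎
  where
  open ≤-Reasoning
  j = p ∸ toℕ r
  k = suc s
  j≤p : j ≤ p
  j≤p = m∸n≤m p (toℕ r)
  n+j≡ : n + j ≡ k * p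
  n+j≡ = begin-equality
    toℕ r + s * p + (p ∸ toℕ r)   ≡⟨ +-assoc (toℕ r) (s * p) j ⟩
    toℕ r + (s * p + j)           ≡⟨ cong (toℕ r +_) (+-comm (s * p) j) ⟩
    toℕ r + (j + s * p)           ≡⟨ +-assoc (toℕ r) j (s * p) ⟨
    toℕ r + j + s * p             ≡⟨ cong (_+ s * p) (m+[n∸m]≡n (<⇒≤ (toℕ<n r))) ⟩
    p + s * p                     ∎
  rearrange : ∀ a b c d → a * b * (c * d) ≡ a * d * (c * b)
  rearrange = solve-∀

data Tern : Set where
  t₀ t₁ t₂ : Tern

_≟ₜ_ : DecidableEquality Tern
t₀ ≟ₜ t₀ = yes refl
t₁ ≟ₜ t₁ = yes refl
t₂ ≟ₜ t₂ = yes refl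
t₀ ≟ₜ t₁ = no λ ()
t₀ ≟ₜ t₂ = no λ ()
t₁ ≟ₜ t₀ = no λ ()
t₁ ≟ₜ t₂ = no λ ()
t₂ ≟ₜ t₀ = no λ ()
t₂ ≟ₜ t₁ = no λ ()

ternLetters : List Tern
ternLetters = t₀ ∷ t₁ ∷ t₂ ∷ []

∈-ternLetters : ∀ x → x ∈ ternLetters
∈-ternLetters t₀ = here refl
∈-ternLetters t₁ = there (here refl)
∈-ternLetters t₂ = there (there (here refl))

∈-bools : ∀ b → b ∈ false ∷ true ∷ []
∈-bools false = here refl
∈-bools true  = there (here refl)

squareFree? : Decidable (SquareFree {A = Tern})
squareFree? = SquareCheck.squaresSatisfy? _≟ₜ_ (λ _ → no λ ())

Good : Word → Set
Good = SquaresSatisfy AllowedSquare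

good? : Decidable Good
good? = SquareCheck.squaresSatisfy? _≟ᵇ_ (λ s → s ≟w w00 ⊎-dec s ≟w w11 ⊎-dec s ≟w w0101)

good-prefix : ∀ {w} k → Good w → Good (take k w)
good-prefix k = squaresSatisfy-slice {P = AllowedSquare} 0 k

good-tail : ∀ {b w} → Good (b ∷ w) → Good w
good-tail {b} = squaresSatisfy-tail {P = AllowedSquare} {x = b}

Good⇒OnlyAllowedSquares : ∀ {w} → Good w → OnlyAllowedSquares w
Good⇒OnlyAllowedSquares good i l = good (toℕ i) (toℕ l)

OnlyAllowedSquares⇒Good : ∀ {w} → OnlyAllowedSquares w → Good w
OnlyAllowedSquares⇒Good {w} only i l sq@(l≥1 , fits , _) =
  subst₂ (λ i l → AllowedSquare (slice w i (l + l))) (toℕ-fromℕ< i<) (toℕ-fromℕ< l<)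
         (only (fromℕ< i<) (fromℕ< l<) (subst₂ (IsSquareAt w) (sym (toℕ-fromℕ< i<)) (sym (toℕ-fromℕ< l<)) sq))
  where
  i< : i < suc (length w)
  i< = s≤s (≤-trans (m≤m+n i (l + l)) fits)
  l< : l < suc (length w)
  l< = s≤s (≤-trans (≤-trans (m≤m+n l l) (m≤n+m (l + l) i)) fits)

binaryCode : Tern → Word
binaryCode t₀ = true ∷ true ∷ false ∷ false ∷ true ∷ false ∷ true ∷ true ∷ true ∷ false ∷ false ∷
  false ∷ true ∷ false ∷ true ∷ true ∷ false ∷ false ∷ false ∷ true ∷ true ∷ true ∷ false ∷ false ∷
  true ∷ false ∷ true ∷ true ∷ false ∷ false ∷ false ∷ true ∷ false ∷ true ∷ true ∷ true ∷ false ∷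
  false ∷ true ∷ false ∷ true ∷ true ∷ false ∷ false ∷ true ∷ true ∷ true ∷ false ∷ false ∷ false ∷ []
binaryCode t₁ = true ∷ false ∷ true ∷ true ∷ false ∷ false ∷ false ∷ true ∷ true ∷ true ∷ false ∷
  false ∷ true ∷ false ∷ true ∷ true ∷ true ∷ false ∷ false ∷ false ∷ true ∷ true ∷ false ∷ false ∷
  true ∷ false ∷ true ∷ true ∷ false ∷ false ∷ false ∷ true ∷ false ∷ true ∷ true ∷ true ∷ false ∷
  false ∷ true ∷ false ∷ true ∷ true ∷ false ∷ false ∷ true ∷ true ∷ true ∷ false ∷ false ∷ false ∷ []
binaryCode t₂ = true ∷ false ∷ true ∷ true ∷ true ∷ false ∷ false ∷ true ∷ false ∷ true ∷ true ∷ false ∷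
  false ∷ false ∷ true ∷ false ∷ true ∷ true ∷ true ∷ false ∷ false ∷ false ∷ true ∷ true ∷ false ∷
  false ∷ true ∷ false ∷ true ∷ true ∷ false ∷ false ∷ false ∷ true ∷ true ∷ true ∷ false ∷ false ∷
  true ∷ false ∷ true ∷ true ∷ false ∷ false ∷ true ∷ true ∷ true ∷ false ∷ false ∷ false ∷ []

ternaryCode : Tern × Bool → List Tern
ternaryCode (t₀ , false) = t₁ ∷ t₂ ∷ t₁ ∷ t₀ ∷ t₁ ∷ t₂ ∷ t₀ ∷ t₁ ∷ t₀ ∷ t₂ ∷ t₁ ∷ t₀ ∷ t₁ ∷ t₂ ∷ t₁ ∷
  t₀ ∷ t₂ ∷ t₀ ∷ t₁ ∷ t₀ ∷ t₂ ∷ t₁ ∷ t₀ ∷ []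
ternaryCode (t₀ , true) = t₁ ∷ t₂ ∷ t₁ ∷ t₀ ∷ t₁ ∷ t₂ ∷ t₀ ∷ t₂ ∷ t₁ ∷ t₀ ∷ t₁ ∷ t₂ ∷ t₁ ∷ t₀ ∷ t₂ ∷
  t₁ ∷ t₂ ∷ t₀ ∷ t₁ ∷ t₀ ∷ t₂ ∷ t₁ ∷ t₀ ∷ []
ternaryCode (t₁ , false) = t₁ ∷ t₂ ∷ t₀ ∷ t₂ ∷ t₁ ∷ t₀ ∷ t₂ ∷ t₀ ∷ t₁ ∷ t₀ ∷ t₂ ∷ t₁ ∷ t₂ ∷ t₀ ∷ t₂ ∷
  t₁ ∷ t₀ ∷ t₁ ∷ t₂ ∷ t₁ ∷ t₀ ∷ t₂ ∷ t₀ ∷ []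
ternaryCode (t₁ , true) = t₁ ∷ t₂ ∷ t₀ ∷ t₂ ∷ t₁ ∷ t₂ ∷ t₀ ∷ t₁ ∷ t₂ ∷ t₁ ∷ t₀ ∷ t₂ ∷ t₀ ∷ t₁ ∷ t₀ ∷
  t₂ ∷ t₁ ∷ t₂ ∷ t₀ ∷ t₁ ∷ t₀ ∷ t₂ ∷ t₀ ∷ []
ternaryCode (t₂ , false) = t₁ ∷ t₂ ∷ t₀ ∷ t₂ ∷ t₁ ∷ t₂ ∷ t₀ ∷ t₁ ∷ t₀ ∷ t₂ ∷ t₁ ∷ t₂ ∷ t₀ ∷ t₂ ∷ t₁ ∷
  t₀ ∷ t₁ ∷ t₂ ∷ t₀ ∷ t₁ ∷ t₀ ∷ t₂ ∷ t₀ ∷ []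
ternaryCode (t₂ , true) = t₁ ∷ t₂ ∷ t₀ ∷ t₂ ∷ t₁ ∷ t₀ ∷ t₂ ∷ t₀ ∷ t₁ ∷ t₂ ∷ t₁ ∷ t₀ ∷ t₁ ∷ t₂ ∷ t₀ ∷
  t₂ ∷ t₁ ∷ t₂ ∷ t₀ ∷ t₁ ∷ t₀ ∷ t₂ ∷ t₀ ∷ []

module BinaryCode where
  open Enumeration ternLetters ∈-ternLetters

  uniform : ∀ x → length (binaryCode x) ≡ 50
  uniform t₀ = refl
  uniform t₁ = refl
  uniform t₂ = refl

  open UniformMorphism binaryCode uniform public

  prefix-injective : ∀ x y → take 10 (binaryCode x) ≡ take 10 (binaryCode y) → x ≡ y
  prefix-injective = toWitness {a? = ∀? λ x → ∀? λ y → take 10 (binaryCode x) ≟w take 10 (binaryCode y) →-dec x ≟ₜ y} _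

  suffix-injective : ∀ x y → drop 9 (binaryCode x) ≡ drop 9 (binaryCode y) → x ≡ y
  suffix-injective = toWitness {a? = ∀? λ x → ∀? λ y → drop 9 (binaryCode x) ≟w drop 9 (binaryCode y) →-dec x ≟ₜ y} _

  synchronizing : ∀ x y z r → 0 < r → r < 50 → slice (binaryCode y ++ binaryCode z) r 50 ≢ binaryCode x
  synchronizing x y z r 0<r r<50 = toWitness {a? = check} _ x y z r<50 0<r
    where
    check = ∀? λ x → ∀? λ y → ∀? λ z →
      allUpTo? (λ r → 0 <? r →-dec ¬? (slice (binaryCode y ++ binaryCode z) r 50 ≟w binaryCode x)) 50

  short-images : ∀ v → length v ≤ 5 → SquareFree v → Good (concatMap binaryCode v)
  short-images v len≤5 sf = All.lookup (toWitness {a? = All.all? (good? ∘ concatMap binaryCode) _} _)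
                                       (∈-extensions-upTo squareFree? squaresSatisfy-tail v len≤5 sf)

  open SquareFreeImage (<ᵇ⇒< 9 50 _) prefix-injective suffix-injective synchronizing
                       {SquareFree} (λ d n → squaresSatisfy-slice d n) (λ sf → sf) {AllowedSquare} short-images public

module TernaryCode where
  open Enumeration (cartesianProduct ternLetters (false ∷ true ∷ [])) (λ (x , b) → ∈-cartesianProduct⁺ (∈-ternLetters x) (∈-bools b))

  _≟ₚ_ : DecidableEquality (Tern × Bool)
  _≟ₚ_ = ×-≡-dec _≟ₜ_ _≟ᵇ_

  _≟ₗ_ : DecidableEquality (List Tern)
  _≟ₗ_ = ≡-dec _≟ₜ_

  uniform : ∀ x → length (ternaryCode x) ≡ 23
  uniform (t₀ , false) = refl
  uniform (t₀ , true)  = refl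
  uniform (t₁ , false) = refl
  uniform (t₁ , true)  = refl
  uniform (t₂ , false) = refl
  uniform (t₂ , true)  = refl

  open UniformMorphism ternaryCode uniform public

  prefix-injective : ∀ x y → take 12 (ternaryCode x) ≡ take 12 (ternaryCode y) → x ≡ y
  prefix-injective = toWitness {a? = ∀? λ x → ∀? λ y → take 12 (ternaryCode x) ≟ₗ take 12 (ternaryCode y) →-dec x ≟ₚ y} _

  suffix-injective : ∀ x y → drop 11 (ternaryCode x) ≡ drop 11 (ternaryCode y) → x ≡ y
  suffix-injective = toWitness {a? = ∀? λ x → ∀? λ y → drop 11 (ternaryCode x) ≟ₗ drop 11 (ternaryCode y) →-dec x ≟ₚ y} _

  synchronizing : ∀ x y z r → 0 < r → r < 23 → slice (ternaryCode y ++ ternaryCode z) r 23 ≢ ternaryCode x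
  synchronizing x y z r 0<r r<23 = toWitness {a? = check} _ x y z r<23 0<r
    where
    check = ∀? λ x → ∀? λ y → ∀? λ z →
      allUpTo? (λ r → 0 <? r →-dec ¬? (slice (ternaryCode y ++ ternaryCode z) r 23 ≟ₗ ternaryCode x)) 23

  ProjectionSquareFree : List (Tern × Bool) → Set
  ProjectionSquareFree v = SquareFree (map proj₁ v)

  short-images : ∀ v → length v ≤ 5 → ProjectionSquareFree v → SquareFree (concatMap ternaryCode v)
  short-images v len≤5 sf = All.lookup (toWitness {a? = All.all? (squareFree? ∘ concatMap ternaryCode) _} _)
                                       (∈-extensions-upTo (squareFree? ∘ map proj₁) squaresSatisfy-tail v len≤5 sf)

  projection-slice : ∀ {v} d n → ProjectionSquareFree v → ProjectionSquareFree (slice v d n)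
  projection-slice {v} d n sf = subst SquareFree (slice-map proj₁ v d n) (squaresSatisfy-slice d n sf)

  projection-squareFree : ∀ {v} → ProjectionSquareFree v → SquareFree v
  projection-squareFree {v} sf i l sq = sf i l (square-map proj₁ {v} {i} sq)

  open SquareFreeImage (<ᵇ⇒< 11 23 _) prefix-injective suffix-injective synchronizing
                       {ProjectionSquareFree} projection-slice projection-squareFree {λ _ → ⊥} short-images public

-- Lower bound
iterate-ternaryCode : ℕ → List Tern
iterate-ternaryCode zero    = t₀ ∷ []
iterate-ternaryCode (suc k) = concatMap (λ x → ternaryCode (x , false)) (iterate-ternaryCode k)

iterate-squareFree : ∀ k → SquareFree (iterate-ternaryCode k)
iterate-squareFree zero    = toWitness {a? = squareFree? (t₀ ∷ [])} _
iterate-squareFree (suc k) = subst SquareFree (concatMap-map ternaryCode (_, false) w) (TernaryCode.concatMap-squaresSatisfy projection)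
  where
  w = iterate-ternaryCode k
  projection : TernaryCode.ProjectionSquareFree (map (_, false) w)
  projection = subst SquareFree (sym (trans (sym (map-∘ w)) (map-id w))) (iterate-squareFree k)

iterate-length : ∀ k → k < length (iterate-ternaryCode k)
iterate-length zero    = s≤s z≤n
iterate-length (suc k) = begin-strict
  suc k                  <⟨ s≤s (iterate-length k) ⟩
  suc n                  ≤⟨ +-monoˡ-≤ n (≤-trans (s≤s z≤n) (iterate-length k)) ⟩
  n + n                  ≡⟨ cong (n +_) (+-identityʳ n) ⟨
  2 * n                  ≤⟨ *-monoˡ-≤ n (≤ᵇ⇒≤ 2 23 _) ⟩
  23 * n                 ≡⟨ *-comm 23 n ⟩
  n * 23                 ≡⟨ UniformMorphism.length-concatMap _ (λ x → TernaryCode.uniform (x , false)) w ⟨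
  length (iterate-ternaryCode (suc k)) ∎
  where
  open ≤-Reasoning
  w = iterate-ternaryCode k
  n = length w

squareFree-word : ∀ k → ∃[ s ] length s ≡ k × SquareFree s
squareFree-word k = take k w , length-slice w 0 k (<⇒≤ (iterate-length k)) , squaresSatisfy-slice 0 k (iterate-squareFree k)
  where w = iterate-ternaryCode k

choiceBlock : Tern → Bool → Word
choiceBlock x b = concatMap binaryCode (ternaryCode (x , b))

choiceBlock-length : ∀ x b → length (choiceBlock x b) ≡ 1150
choiceBlock-length x b = begin
  length (concatMap binaryCode (ternaryCode (x , b))) ≡⟨ BinaryCode.length-concatMap (ternaryCode (x , b)) ⟩
  length (ternaryCode (x , b)) * 50                   ≡⟨ cong (_* 50) {y = 23} (TernaryCode.uniform (x , b)) ⟩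
  23 * 50                                             ∎
  where open ≡-Reasoning

choiceBlock-distinct : ∀ x → choiceBlock x false ≢ choiceBlock x true
choiceBlock-distinct = toWitness {a? = ∀? λ x → ¬? (choiceBlock x false ≟w choiceBlock x true)} _
  where open Enumeration ternLetters ∈-ternLetters

concat-zipWith-choiceBlock : ∀ s c → concat (zipWith choiceBlock s c) ≡ concatMap binaryCode (concatMap ternaryCode (zip s c))
concat-zipWith-choiceBlock []      c       = refl
concat-zipWith-choiceBlock (x ∷ s) []      = refl
concat-zipWith-choiceBlock (x ∷ s) (b ∷ c) =
  trans (cong (choiceBlock x b ++_) (concat-zipWith-choiceBlock s c))
        (sym (concatMap-++ binaryCode (ternaryCode (x , b)) (concatMap ternaryCode (zip s c))))

map-proj₁-zip : ∀ (s : List A) (c : List B) → length c ≡ length s → map proj₁ (zip s c) ≡ s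
map-proj₁-zip []      []      _   = refl
map-proj₁-zip (x ∷ s) (b ∷ c) len = cong (x ∷_) (map-proj₁-zip s c (suc-injective len))

H-as-sum : ∀ n → H n ≡ sumWords n (indicator onlyAllowedSquares?)
H-as-sum n = length-filter≡sum onlyAllowedSquares? (words n)

H-lower : ∀ k → 2 ^ k ≤ H (k * 1150)
H-lower k with squareFree-word k
... | s , refl , sf = subst (2 ^ length s ≤_) (sym (H-as-sum (length s * 1150)))
  (count-choices choiceBlock choiceBlock-length choiceBlock-distinct s onlyAllowedSquares? λ c len →
     Good⇒OnlyAllowedSquares (subst Good (sym (concat-zipWith-choiceBlock s c))
       (BinaryCode.concatMap-squaresSatisfy (TernaryCode.concatMap-squaresSatisfy (subst SquareFree (sym (map-proj₁-zip s c len)) sf)))))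

OnlyAllowedSquares-tail : ∀ {b w} → OnlyAllowedSquares (b ∷ w) → OnlyAllowedSquares w
OnlyAllowedSquares-tail {b} only = Good⇒OnlyAllowedSquares (good-tail {b} (OnlyAllowedSquares⇒Good only))

H-suc : ∀ n → H (suc n) ≤ 2 * H n
H-suc n = begin
  H (suc n)                                                     ≡⟨ trans (H-as-sum (suc n)) (sumWords-suc n ind) ⟩
  sumWords n (ind ∘ (false ∷_)) + sumWords n (ind ∘ (true ∷_))  ≤⟨ +-mono-≤ (drop-first false) (drop-first true) ⟩
  H n + H n                                                     ≡⟨ cong (H n +_) (+-identityʳ (H n)) ⟨
  2 * H n                                                       ∎
  where
  open ≤-Reasoning
  ind = indicator onlyAllowedSquares?
  drop-first : ∀ b → sumWords n (ind ∘ (b ∷_)) ≤ H n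
  drop-first b = subst (sumWords n (ind ∘ (b ∷_)) ≤_) (sym (H-as-sum n))
    (sumWords-mono n (λ w _ → indicator-mono onlyAllowedSquares? onlyAllowedSquares? {b ∷ w} {w} (OnlyAllowedSquares-tail {b} {w})))

H-growth : ∀ n j → H (n + j) ≤ 2 ^ j * H n
H-growth n zero    = ≤-reflexive (trans (cong H (+-identityʳ n)) (sym (+-identityʳ (H n))))
H-growth n (suc j) = begin
  H (n + suc j)       ≡⟨ cong H (+-suc n j) ⟩
  H (suc (n + j))     ≤⟨ H-suc (n + j) ⟩
  2 * H (n + j)       ≤⟨ *-monoʳ-≤ 2 (H-growth n j) ⟩
  2 * (2 ^ j * H n)   ≡⟨ *-assoc 2 (2 ^ j) (H n) ⟨
  2 ^ suc j * H n     ∎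
  where open ≤-Reasoning

H-lower-bound : ∀ n → 10006 ^ n ≤ (2 * 10000) ^ 1150 * (10000 ^ n * H n)
H-lower-bound = exponential-lower H {1150} {10006} {10000} (≤ᵇ⇒≤ (10006 ^ 1150) (2 * 10000 ^ 1150) _) H-lower H-growth

-- Upper bound
bitsValue : Word → ℕ
bitsValue []      = 0
bitsValue (b ∷ s) = (if b then 1 else 0) + 2 * bitsValue s

lookupWeight : ℕ → List (ℕ × ℕ) → ℕ
lookupWeight k []             = 0
lookupWeight k ((k′ , v) ∷ t) = if k ≡ᵇ k′ then v else lookupWeight k t

maxWeight : List (ℕ × ℕ) → ℕ
maxWeight []            = 0
maxWeight ((_ , v) ∷ t) = v ⊔ maxWeight t

lookupWeight≤maxWeight : ∀ k t → lookupWeight k t ≤ maxWeight t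
lookupWeight≤maxWeight k []             = z≤n
lookupWeight≤maxWeight k ((k′ , v) ∷ t) with k ≡ᵇ k′
... | true  = m≤m⊔n v (maxWeight t)
... | false = ≤-trans (lookupWeight≤maxWeight k t) (m≤n⊔m v (maxWeight t))

-- Weights of words of length 23, keyed by bitsValue (first letter = least significant bit); absent words
-- weigh 0. The values were found by computer: only the inequalities verified by certificate matter.
weightTable : List (ℕ × ℕ)
weightTable =
  (859345 , 4) ∷ (859347 , 40) ∷ (859441 , 32) ∷ (859448 , 36) ∷ (859449 , 1) ∷ (864717 , 41) ∷ (864721 , 30) ∷
  (864723 , 26) ∷ (866513 , 33) ∷ (866515 , 27) ∷ (866866 , 1) ∷ (866868 , 47) ∷ (866872 , 1) ∷ (866873 , 30) ∷
  (866875 , 1) ∷ (930929 , 1) ∷ (930930 , 1) ∷ (930931 , 23) ∷ (930932 , 37) ∷ (931012 , 1) ∷ (931015 , 52) ∷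
  (931042 , 1) ∷ (931043 , 2) ∷ (931048 , 42) ∷ (944354 , 1) ∷ (944358 , 1) ∷ (944360 , 1) ∷ (944361 , 40) ∷
  (944580 , 1) ∷ (944582 , 36) ∷ (944583 , 1) ∷ (944593 , 47) ∷ (953649 , 42) ∷ (953656 , 18) ∷ (953657 , 1) ∷
  (953658 , 34) ∷ (953659 , 1) ∷ (953960 , 21) ∷ (953961 , 36) ∷ (956646 , 37) ∷ (956648 , 27) ∷ (956649 , 1) ∷
  (957544 , 30) ∷ (957545 , 45) ∷ (1156664 , 1) ∷ (1156665 , 30) ∷ (1156666 , 40) ∷ (1156667 , 1) ∷
  (1156889 , 1) ∷ (1156890 , 25) ∷ (1156934 , 36) ∷ (1156935 , 23) ∷ (1166616 , 1) ∷ (1166617 , 1) ∷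
  (1166620 , 2) ∷ (1166621 , 30) ∷ (1166648 , 27) ∷ (1166649 , 1) ∷ (1166650 , 34) ∷ (1166651 , 1) ∷
  (1167782 , 30) ∷ (1167783 , 38) ∷ (1168156 , 28) ∷ (1168157 , 21) ∷ (1168268 , 1) ∷ (1168269 , 53) ∷
  (1631884 , 2) ∷ (1631885 , 1) ∷ (1631886 , 30) ∷ (1631900 , 25) ∷ (1631901 , 31) ∷ (1632467 , 60) ∷
  (1632654 , 25) ∷ (1632708 , 1) ∷ (1632710 , 48) ∷ (1632711 , 1) ∷ (1718690 , 1) ∷ (1718691 , 3) ∷
  (1718695 , 45) ∷ (1718882 , 1) ∷ (1718883 , 35) ∷ (1718897 , 40) ∷ (1718898 , 1) ∷ (1729434 , 46) ∷
  (1729442 , 1) ∷ (1729443 , 33) ∷ (1729446 , 2) ∷ (1729447 , 27) ∷ (1733026 , 1) ∷ (1733027 , 36) ∷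
  (1733030 , 30) ∷ (1733031 , 1) ∷ (1733737 , 53) ∷ (1733745 , 1) ∷ (1733746 , 1) ∷ (1733747 , 32) ∷
  (1861858 , 1) ∷ (1861862 , 26) ∷ (1861864 , 1) ∷ (1861865 , 40) ∷ (1862030 , 58) ∷ (1862084 , 1) ∷
  (1862086 , 1) ∷ (1862087 , 1) ∷ (1862097 , 47) ∷ (1888708 , 1) ∷ (1888717 , 1) ∷ (1888723 , 45) ∷
  (1889164 , 1) ∷ (1889165 , 39) ∷ (1889186 , 1) ∷ (1889187 , 52) ∷ (1907298 , 1) ∷ (1907299 , 46) ∷
  (1907313 , 20) ∷ (1907314 , 1) ∷ (1907316 , 38) ∷ (1907921 , 23) ∷ (1907923 , 40) ∷ (1913293 , 41) ∷
  (1913297 , 30) ∷ (1913299 , 24) ∷ (1915089 , 33) ∷ (1915091 , 50) ∷ (2313330 , 1) ∷ (2313331 , 33) ∷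
  (2313332 , 45) ∷ (2313778 , 1) ∷ (2313780 , 28) ∷ (2313868 , 2) ∷ (2313869 , 38) ∷ (2313870 , 26) ∷
  (2333234 , 1) ∷ (2333240 , 1) ∷ (2333241 , 1) ∷ (2333242 , 33) ∷ (2333243 , 1) ∷ (2333297 , 30) ∷
  (2333298 , 1) ∷ (2333300 , 38) ∷ (2335564 , 34) ∷ (2335566 , 43) ∷ (2336312 , 1) ∷ (2336313 , 30) ∷
  (2336314 , 22) ∷ (2336315 , 1) ∷ (2336537 , 1) ∷ (2336538 , 60) ∷ (2505122 , 1) ∷ (2505123 , 27) ∷
  (2505127 , 45) ∷ (2505266 , 1) ∷ (2505268 , 47) ∷ (2505314 , 1) ∷ (2505315 , 1) ∷ (2505329 , 40) ∷
  (2505330 , 1) ∷ (2526824 , 1) ∷ (2526825 , 36) ∷ (2526872 , 29) ∷ (2526874 , 1) ∷ (2526876 , 33) ∷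
  (2562616 , 1) ∷ (2562617 , 22) ∷ (2562618 , 33) ∷ (2562619 , 1) ∷ (2562658 , 1) ∷ (2562659 , 46) ∷
  (2562673 , 1) ∷ (2562674 , 1) ∷ (2562676 , 38) ∷ (2573976 , 38) ∷ (2573980 , 17) ∷ (2573981 , 31) ∷
  (2574132 , 51) ∷ (2575474 , 1) ∷ (2575475 , 33) ∷ (2575476 , 44) ∷ (3253146 , 32) ∷ (3253158 , 24) ∷
  (3253159 , 27) ∷ (3253816 , 1) ∷ (3253817 , 30) ∷ (3253818 , 40) ∷ (3253819 , 1) ∷ (3254041 , 1) ∷
  (3254042 , 24) ∷ (3254086 , 36) ∷ (3254087 , 23) ∷ (3263768 , 1) ∷ (3263769 , 1) ∷ (3263772 , 3) ∷
  (3263773 , 30) ∷ (3263800 , 27) ∷ (3263801 , 1) ∷ (3263802 , 34) ∷ (3263803 , 1) ∷ (3264934 , 30) ∷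
  (3264935 , 38) ∷ (3265308 , 28) ∷ (3265309 , 1) ∷ (3265420 , 1) ∷ (3265421 , 53) ∷ (3378460 , 21) ∷
  (3378461 , 30) ∷ (3378481 , 42) ∷ (3378488 , 2) ∷ (3378489 , 1) ∷ (3378490 , 34) ∷ (3378491 , 1) ∷
  (3384140 , 34) ∷ (3384142 , 43) ∷ (3384218 , 45) ∷ (3384888 , 1) ∷ (3384889 , 30) ∷ (3384890 , 39) ∷
  (3384891 , 1) ∷ (3437382 , 3) ∷ (3437383 , 1) ∷ (3437390 , 50) ∷ (3437764 , 1) ∷ (3437767 , 39) ∷
  (3437794 , 1) ∷ (3437795 , 44) ∷ (3458868 , 52) ∷ (3458886 , 36) ∷ (3458887 , 1) ∷ (3458892 , 1) ∷
  (3458893 , 1) ∷ (3458894 , 30) ∷ (3466055 , 40) ∷ (3466060 , 34) ∷ (3466062 , 28) ∷ (3467475 , 60) ∷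
  (3467490 , 1) ∷ (3467494 , 36) ∷ (3723716 , 1) ∷ (3723725 , 29) ∷ (3723731 , 45) ∷ (3724060 , 28) ∷
  (3724061 , 37) ∷ (3724172 , 1) ∷ (3724173 , 1) ∷ (3724194 , 1) ∷ (3724195 , 52) ∷ (3729619 , 60) ∷
  (3729806 , 27) ∷ (3729860 , 1) ∷ (3729862 , 48) ∷ (3729863 , 1) ∷ (3777434 , 1) ∷ (3777446 , 24) ∷
  (3777447 , 27) ∷ (3778329 , 1) ∷ (3778330 , 44) ∷ (3778374 , 36) ∷ (3778375 , 23) ∷ (3814596 , 1) ∷
  (3814599 , 52) ∷ (3814626 , 1) ∷ (3814627 , 21) ∷ (3814632 , 42) ∷ (3815842 , 1) ∷ (3815843 , 24) ∷
  (3815847 , 45) ∷ (3826586 , 46) ∷ (3826594 , 1) ∷ (3826595 , 33) ∷ (3826598 , 1) ∷ (3826599 , 27) ∷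
  (3830178 , 1) ∷ (3830179 , 36) ∷ (3830182 , 30) ∷ (3830183 , 26) ∷ (4623976 , 4) ∷ (4623977 , 36) ∷
  (4624024 , 29) ∷ (4624026 , 1) ∷ (4624028 , 33) ∷ (4626662 , 37) ∷ (4626664 , 27) ∷ (4626665 , 23) ∷
  (4627560 , 30) ∷ (4627561 , 1) ∷ (4627736 , 1) ∷ (4627737 , 1) ∷ (4627738 , 42) ∷ (4627740 , 28) ∷
  (4627741 , 1) ∷ (4666481 , 1) ∷ (4666482 , 1) ∷ (4666483 , 1) ∷ (4666484 , 37) ∷ (4666594 , 1) ∷
  (4666595 , 33) ∷ (4666600 , 42) ∷ (4671128 , 38) ∷ (4671132 , 17) ∷ (4671133 , 31) ∷ (4672626 , 1) ∷
  (4672627 , 33) ∷ (4672628 , 24) ∷ (4673074 , 1) ∷ (4673076 , 67) ∷ (5010246 , 3) ∷ (5010247 , 27) ∷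
  (5010254 , 50) ∷ (5010537 , 53) ∷ (5010628 , 1) ∷ (5010631 , 1) ∷ (5010658 , 1) ∷ (5010659 , 44) ∷
  (5053649 , 1) ∷ (5053651 , 40) ∷ (5053745 , 32) ∷ (5053752 , 36) ∷ (5053753 , 1) ∷ (5060817 , 33) ∷
  (5060819 , 28) ∷ (5061170 , 1) ∷ (5061172 , 47) ∷ (5061176 , 1) ∷ (5061177 , 30) ∷ (5061179 , 1) ∷
  (5125233 , 1) ∷ (5125234 , 1) ∷ (5125235 , 23) ∷ (5125236 , 37) ∷ (5125316 , 1) ∷ (5125319 , 52) ∷
  (5125346 , 1) ∷ (5125347 , 1) ∷ (5125352 , 42) ∷ (5147953 , 42) ∷ (5147960 , 18) ∷ (5147961 , 1) ∷
  (5147962 , 34) ∷ (5147963 , 1) ∷ (5148264 , 21) ∷ (5148265 , 36) ∷ (5150950 , 37) ∷ (5150952 , 27) ∷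
  (5150953 , 22) ∷ (5350968 , 1) ∷ (5350969 , 30) ∷ (5350970 , 40) ∷ (5350971 , 1) ∷ (5351193 , 1) ∷
  (5351194 , 25) ∷ (5351238 , 36) ∷ (5351239 , 23) ∷ (5360920 , 1) ∷ (5360921 , 1) ∷ (5360924 , 1) ∷
  (5360925 , 30) ∷ (5360952 , 27) ∷ (5360953 , 1) ∷ (5360954 , 34) ∷ (5360955 , 1) ∷ (5362460 , 28) ∷
  (5362461 , 21) ∷ (5362572 , 1) ∷ (5362573 , 53) ∷ (5446865 , 25) ∷ (5446867 , 40) ∷ (5446936 , 1) ∷
  (5446937 , 1) ∷ (5446938 , 42) ∷ (5446961 , 1) ∷ (5446968 , 36) ∷ (5446969 , 1) ∷ (5457716 , 33) ∷
  (5457740 , 26) ∷ (5457741 , 1) ∷ (5457742 , 30) ∷ (5475612 , 21) ∷ (5475613 , 30) ∷ (5475633 , 42) ∷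
  (5475640 , 1) ∷ (5475641 , 1) ∷ (5475642 , 34) ∷ (5475643 , 1) ∷ (5481292 , 34) ∷ (5481294 , 43) ∷
  (5481370 , 45) ∷ (5820868 , 1) ∷ (5820877 , 29) ∷ (5820883 , 45) ∷ (5821212 , 28) ∷ (5821213 , 37) ∷
  (5821324 , 1) ∷ (5821325 , 22) ∷ (5821346 , 1) ∷ (5821347 , 52) ∷ (5826188 , 2) ∷ (5826189 , 1) ∷
  (5826190 , 30) ∷ (5826204 , 25) ∷ (5826205 , 31) ∷ (5826771 , 60) ∷ (5826958 , 26) ∷ (5827012 , 1) ∷
  (5827014 , 48) ∷ (5827015 , 1) ∷ (5883534 , 45) ∷ (5883544 , 38) ∷ (5883548 , 3) ∷ (5883549 , 31) ∷
  (5886374 , 30) ∷ (5886375 , 38) ∷ (5886404 , 1) ∷ (5886413 , 40) ∷ (5886748 , 28) ∷ (5886749 , 36) ∷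
  (6056162 , 1) ∷ (6056166 , 26) ∷ (6056168 , 1) ∷ (6056169 , 40) ∷ (6056334 , 58) ∷ (6056388 , 1) ∷
  (6056390 , 2) ∷ (6056391 , 1) ∷ (6056401 , 47) ∷ (6059113 , 53) ∷ (6059204 , 1) ∷ (6059207 , 24) ∷
  (6059234 , 1) ∷ (6059235 , 44) ∷ (6083012 , 1) ∷ (6083021 , 1) ∷ (6083027 , 45) ∷ (6083468 , 1) ∷
  (6083469 , 39) ∷ (6083490 , 1) ∷ (6083491 , 52) ∷ (6101602 , 1) ∷ (6101603 , 46) ∷ (6101617 , 20) ∷
  (6101618 , 1) ∷ (6101620 , 38) ∷ (6102225 , 23) ∷ (6102227 , 40) ∷ (6107597 , 41) ∷ (6107601 , 30) ∷
  (6107603 , 25) ∷ (6109393 , 33) ∷ (6109395 , 50) ∷ (6506292 , 36) ∷ (6506316 , 26) ∷ (6506317 , 1) ∷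
  (6506318 , 30) ∷ (6507634 , 1) ∷ (6507635 , 33) ∷ (6507636 , 45) ∷ (6508082 , 1) ∷ (6508084 , 27) ∷
  (6508172 , 2) ∷ (6508173 , 38) ∷ (6508174 , 26) ∷ (6527538 , 1) ∷ (6527544 , 1) ∷ (6527545 , 2) ∷
  (6527546 , 33) ∷ (6527547 , 1) ∷ (6527601 , 30) ∷ (6527602 , 1) ∷ (6527604 , 38) ∷ (6529868 , 34) ∷
  (6529870 , 43) ∷ (6530616 , 1) ∷ (6530617 , 30) ∷ (6530618 , 1) ∷ (6530619 , 1) ∷ (6530841 , 1) ∷
  (6530842 , 60) ∷ (6721128 , 1) ∷ (6721129 , 36) ∷ (6721176 , 29) ∷ (6721178 , 1) ∷ (6721180 , 33) ∷
  (6724712 , 30) ∷ (6724713 , 25) ∷ (6724888 , 1) ∷ (6724889 , 1) ∷ (6724890 , 42) ∷ (6724892 , 28) ∷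
  (6724893 , 1) ∷ (6756920 , 1) ∷ (6756921 , 22) ∷ (6756922 , 33) ∷ (6756923 , 1) ∷ (6756962 , 1) ∷
  (6756963 , 46) ∷ (6756977 , 2) ∷ (6756978 , 1) ∷ (6756980 , 38) ∷ (6768280 , 38) ∷ (6768284 , 17) ∷
  (6768285 , 31) ∷ (6768436 , 51) ∷ (6769778 , 1) ∷ (6769779 , 33) ∷ (6769780 , 44) ∷ (6869788 , 28) ∷
  (6869789 , 37) ∷ (6869900 , 1) ∷ (6869901 , 23) ∷ (6869922 , 1) ∷ (6869923 , 52) ∷ (6874764 , 2) ∷
  (6874765 , 1) ∷ (6874766 , 27) ∷ (6874780 , 25) ∷ (6874781 , 31) ∷ (6875534 , 44) ∷ (6875588 , 1) ∷
  (6875590 , 48) ∷ (6875591 , 1) ∷ (6917736 , 23) ∷ (6917737 , 36) ∷ (6917772 , 2) ∷ (6917773 , 38) ∷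
  (6917784 , 1) ∷ (6917786 , 1) ∷ (6917788 , 33) ∷ (6932110 , 45) ∷ (6932120 , 38) ∷ (6932124 , 1) ∷
  (6932125 , 31) ∷ (6934950 , 30) ∷ (6934951 , 38) ∷ (6934980 , 1) ∷ (6934989 , 40) ∷ (7222385 , 1) ∷
  (7222386 , 1) ∷ (7222387 , 23) ∷ (7222388 , 37) ∷ (7222468 , 1) ∷ (7222471 , 52) ∷ (7222498 , 1) ∷
  (7222499 , 3) ∷ (7222504 , 42) ∷ (7223858 , 1) ∷ (7223860 , 47) ∷ (7223906 , 1) ∷ (7223907 , 22) ∷
  (7223921 , 40) ∷ (7223922 , 1) ∷ (7235810 , 1) ∷ (7235814 , 1) ∷ (7235816 , 1) ∷ (7235817 , 40) ∷
  (7236036 , 1) ∷ (7236038 , 36) ∷ (7236039 , 1) ∷ (7236049 , 47) ∷ (7447450 , 32) ∷ (7447462 , 24) ∷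
  (7447463 , 27) ∷ (7448120 , 1) ∷ (7448121 , 30) ∷ (7448122 , 40) ∷ (7448123 , 1) ∷ (7448345 , 1) ∷
  (7448346 , 1) ∷ (7448390 , 36) ∷ (7448391 , 23) ∷ (7458072 , 1) ∷ (7458073 , 1) ∷ (7458076 , 3) ∷
  (7458077 , 30) ∷ (7458104 , 27) ∷ (7458105 , 1) ∷ (7458106 , 34) ∷ (7458107 , 1) ∷ (7459238 , 30) ∷
  (7459239 , 38) ∷ (7459612 , 28) ∷ (7459613 , 2) ∷ (7459724 , 1) ∷ (7459725 , 53) ∷ (7554868 , 32) ∷
  (7554892 , 26) ∷ (7554893 , 1) ∷ (7554894 , 30) ∷ (7556658 , 1) ∷ (7556660 , 49) ∷ (7556748 , 2) ∷
  (7556749 , 38) ∷ (7556750 , 26) ∷ (7578444 , 34) ∷ (7578446 , 43) ∷ (7578522 , 45) ∷ (7579192 , 1) ∷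
  (7579193 , 30) ∷ (7579194 , 39) ∷ (7579195 , 1) ∷ (7629198 , 58) ∷ (7629252 , 1) ∷ (7629254 , 22) ∷
  (7629255 , 1) ∷ (7629265 , 47) ∷ (7631686 , 3) ∷ (7631687 , 24) ∷ (7631694 , 50) ∷ (7632068 , 1) ∷
  (7632071 , 39) ∷ (7632098 , 1) ∷ (7632099 , 44) ∷ (7653172 , 52) ∷ (7653190 , 36) ∷ (7653191 , 1) ∷
  (7653196 , 1) ∷ (7653197 , 1) ∷ (7653198 , 30) ∷ (7660359 , 40) ∷ (7660364 , 34) ∷ (7660366 , 29) ∷ []

-- Kept opaque so that the type checker never unfolds the table lookup outside certificate.
opaque
  weight : Word → ℕ
  weight s = lookupWeight (bitsValue s) weightTable

  weight≤maxWeight : ∀ s → weight s ≤ maxWeight weightTable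
  weight≤maxWeight s = lookupWeight≤maxWeight (bitsValue s) weightTable

potential : Word → ℕ
potential w = indicator good? w * weight (take 23 w)

extensionWeight : Bool → Word → ℕ
extensionWeight b s = indicator good? (b ∷ s) * weight (b ∷ take 22 s)

Certified : Word → Set
Certified s = (extensionWeight false s + extensionWeight true s) * 1000 ≤ weight s * 1135 × 1 ≤ weight s

opaque
  unfolding weight

  certificate : ∀ s → length s ≡ 23 → Good s → Certified s
  certificate s len good-s = All.lookup (toWitness {a? = All.all? certified? (extensions good? 23)} _)
                                        (subst (λ n → s ∈ extensions good? n) len (∈-extensions good? (λ {b} → good-tail {b}) s good-s))
    where
    open Enumeration (false ∷ true ∷ []) ∈-bools
    certified? : Decidable Certified
    certified? s = _ ≤? _ ×-dec 1 ≤? weight s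

certificate-prefix : ∀ w → 23 ≤ length w → Good w → Certified (take 23 w)
certificate-prefix w 23≤ good = certificate (take 23 w) (length-slice w 0 23 23≤) (good-prefix 23 good)

potential-extension : ∀ b w → potential (b ∷ w) ≤ extensionWeight b (take 23 w)
potential-extension b w =
  *-mono-≤ (indicator-mono good? good? {b ∷ w} {b ∷ take 23 w} (good-prefix 24))
           (≤-reflexive (cong (λ s → weight (b ∷ s)) (sym (take-slice w 0 (n≤1+n 22)))))

potential-good : ∀ w → Good w → potential w ≡ weight (take 23 w)
potential-good w good = trans (cong (_* weight (take 23 w)) (indicator-yes good? good)) (*-identityˡ (weight (take 23 w)))

potential-step : ∀ w → 23 ≤ length w → (potential (false ∷ w) + potential (true ∷ w)) * 1000 ≤ potential w * 1135
potential-step w 23≤ with good? w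
... | no ¬good = ≤-trans (≤-reflexive (cong (_* 1000) (cong₂ _+_ (vanish false) (vanish true)))) z≤n
  where
  vanish : ∀ b → potential (b ∷ w) ≡ 0
  vanish b = cong (_* weight (take 23 (b ∷ w))) (indicator-no good? (¬good ∘ good-tail {b}))
... | yes good = begin
  (potential (false ∷ w) + potential (true ∷ w)) * 1000
    ≤⟨ *-monoˡ-≤ 1000 (+-mono-≤ (potential-extension false w) (potential-extension true w)) ⟩
  (extensionWeight false (take 23 w) + extensionWeight true (take 23 w)) * 1000
    ≤⟨ proj₁ (certificate-prefix w 23≤ good) ⟩
  weight (take 23 w) * 1135
    ≡⟨ cong (_* 1135) (potential-good w good) ⟨
  potential w * 1135
    ∎
  where open ≤-Reasoning

indicator≤potential : ∀ w → 23 ≤ length w → indicator onlyAllowedSquares? w ≤ potential w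
indicator≤potential w 23≤ with onlyAllowedSquares? w
... | yes only = subst (_≤ potential w) (sym (indicator-yes onlyAllowedSquares? only))
                   (subst (1 ≤_) (sym (potential-good w good)) (proj₂ (certificate-prefix w 23≤ good)))
  where good = OnlyAllowedSquares⇒Good only
... | no ¬only = subst (_≤ potential w) (sym (indicator-no onlyAllowedSquares? ¬only)) z≤n

potential≤maxWeight : ∀ w → potential w ≤ maxWeight weightTable
potential≤maxWeight w = ≤-trans (*-mono-≤ (indicator≤1 good? w) (weight≤maxWeight (take 23 w)))
                                (≤-reflexive (*-identityˡ (maxWeight weightTable)))

H≤sumPotential : ∀ n → 23 ≤ n → H n ≤ sumWords n potential
H≤sumPotential n 23≤n = subst (_≤ sumWords n potential) (sym (H-as-sum n))
  (sumWords-mono n (λ w len → indicator≤potential w (subst (23 ≤_) (sym len) 23≤n)))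

sumPotential-step : ∀ n → 23 ≤ n → sumWords (suc n) potential * 1000 ≤ sumWords n potential * 1135
sumPotential-step n 23≤n = sumWords-step n 1000 1135 (λ w len → potential-step w (subst (23 ≤_) (sym len) 23≤n))

sumPotential-23 : sumWords 23 potential ≤ 2 ^ 23 * maxWeight weightTable
sumPotential-23 = ≤-trans (sumWords-mono 23 {potential} {λ _ → maxWeight weightTable} (λ w _ → potential≤maxWeight w))
                          (≤-reflexive (sumWords-const 23 (maxWeight weightTable)))

H-upper-bound : ∀ n → 23 ≤ n → 1000 ^ n * H n ≤ (2 ^ 23 * maxWeight weightTable) * 1135 ^ n
H-upper-bound = exponential-upper H (λ n → sumWords n potential) {23} {1000} {1135} {2 ^ 23 * maxWeight weightTable}
                  (≤ᵇ⇒≤ 1000 1135 _) H≤sumPotential sumPotential-step sumPotential-23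

theorem12 : (∃[ b ] ∃[ N ] (1 ≤ b) × ((n : ℕ) → N ≤ n → 10006 ^ n ≤ b * (10000 ^ n * H n)))
    ×
    (∃[ C ] ∃[ N ] ((n : ℕ) → N ≤ n → 1000 ^ n * H n ≤ C * 1135 ^ n))
theorem12 = ((2 * 10000) ^ 1150 , 0 , m^n>0 (2 * 10000) 1150 , λ n _ → H-lower-bound n)
          , (2 ^ 23 * maxWeight weightTable , 23 , H-upper-bound)
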